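{- Let $f\ge2$ be an integer, $l$ an odd prime with $l=ef+1$, and $K$ a field with $\operatorname{char}K\nmid f!$, $\operatorname{char}K\ne l$, and $\operatorname{Gal}(K(\zeta_l)/K)\simeq(\mathbb{Z}/l\mathbb{Z})^\times=\langle\gamma\rangle$; put $\beta=\gamma^e$. Then the $f$-ic form on $K^{l-1}$ $$h({\bf x})=\sum_{i_0+\beta i_1+\cdots+\beta^{f-1}i_{f-1}\equiv0\ (l)}x_{i_0}\cdots x_{i_{f-1}}-\sum_{i_0+\beta i_1+\cdots+\beta^{f-1}i_{f-1}\equiv\gamma\ (l)}x_{i_0}\cdots x_{i_{f-1}}$$ (sums over $(i_0,\dots,i_{f-1})\in(\mathbb{Z}/l\mathbb{Z})^f$, subscripts mod $l$, $x_0=0$) is regular.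
   Context: For an $f$-ic form $h$ on $K^n$ with $\operatorname{char}K\nmid f!$, let $\theta_h$ be its associated symmetric $f$-linear form (so $h({\bf x})=\theta_h({\bf x},\dots,{\bf x})$). $h$ is regular if $\theta_h({\bf v}_1,{\bf v}_2,\dots,{\bf v}_f)=0$ for all ${\bf v}_2,\dots,{\bf v}_f\in K^n$ implies ${\bf v}_1=0$. -}

module Defs where

open import Level using (Level; _⊔_)
open import Algebra.Bundles using (CommutativeRing)
open import Data.Nat as ℕ using (ℕ; zero; suc; _%_; _^_; _≟_; NonZero)
open import Data.Fin using (Fin; zero; suc; toℕ)
open import Data.Bool using (Bool; true; false; if_then_else_)
open import Data.Product using (Σ; _×_; ∃; ∃-syntax)
open import Data.Vec.Functional using (_∷_)
open import Relation.Nullary using (¬_)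
open import Relation.Nullary.Decidable using (⌊_⌋)
open import Relation.Binary.PropositionalEquality using (_≡_)

record Field (c ℓ : Level) : Set (Level.suc (c ⊔ ℓ)) where
  field
    commutativeRing : CommutativeRing c ℓ
  open CommutativeRing commutativeRing public
  field
    1≉0     : ¬ (1# ≈ 0#)
    inverse : ∀ x → ¬ (x ≈ 0#) → ∃[ y ] (x * y ≈ 1#)

IsGeneratorMod : (l : ℕ) .{{_ : NonZero l}} → ℕ → Set
IsGeneratorMod l g = ∀ a → ¬ (a % l ≡ 0) → ∃[ k ] (g ^ k % l ≡ a % l)

module FieldStuff {c ℓ} (F : Field c ℓ) where
  open Field F using (Carrier; _≈_; _+_; _*_; -_; _-_; 0#; 1#)

  ι : ℕ → Carrier
  ι zero    = 0#
  ι (suc n) = 1# + ι n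

  sumFin : (n : ℕ) → (Fin n → Carrier) → Carrier
  sumFin zero    g = 0#
  sumFin (suc n) g = g zero + sumFin n (λ i → g (suc i))

  prodFin : (n : ℕ) → (Fin n → Carrier) → Carrier
  prodFin zero    g = 1#
  prodFin (suc n) g = g zero * prodFin n (λ i → g (suc i))

  sumTuples : (f l : ℕ) → ((Fin f → Fin l) → Carrier) → Carrier
  sumTuples zero    l g = g (λ ())
  sumTuples (suc f) l g = sumFin l (λ i → sumTuples f l (λ t → g (i ∷ t)))

  Vect : ℕ → Set c
  Vect n = Fin n → Carrier

  _⊕_ : ∀ {n} → Vect n → Vect n → Vect n
  (u ⊕ v) i = u i + v i

  zeroV : ∀ {n} → Vect n
  zeroV i = 0#

  Poly : Set c
  Poly = ℕ → Carrier

  DegLe : Poly → ℕ → Set ℓ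
  DegLe p d = ∀ k → d ℕ.< k → p k ≈ 0#

  _·_ : Poly → Poly → Poly
  (p · q) k = sumFin (suc k) (λ i → p (toℕ i) * q (k ℕ.∸ toℕ i))

  -- the l-th cyclotomic polynomial Φ_l = 1 + x + ⋯ + x^{l-1} (l prime)
  cyclotomic : ℕ → Poly
  cyclotomic l k = if ⌊ k ℕ.<? l ⌋ then 1# else 0#

  Irreducible : Poly → ℕ → Set (c ⊔ ℓ)
  Irreducible P d =
    ¬ (Σ Poly λ p → Σ Poly λ q → Σ ℕ λ a → Σ ℕ λ b →
         (1 ℕ.≤ a) × (1 ℕ.≤ b) × (a ℕ.+ b ≡ d) × DegLe p a × DegLe q b ×
         (∀ k → (p · q) k ≈ P k))

  -- The symmetric f-linear form θ_h associated with an f-ic form h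
  -- (given by the polarization formula)
  --   θ_h(v₁,…,v_f) = (f!)⁻¹ Σ_{S ⊆ {1..f}} (-1)^{f-|S|} h(Σ_{j∈S} v_j)
  -- where (f!)⁻¹ is the inverse of f!·1 in K (assumed nonzero).

  sumVecs : ∀ {n} (f : ℕ) → (Fin f → Bool) → (Fin f → Vect n) → Vect n
  sumVecs zero    S v = zeroV
  sumVecs (suc f) S v =
    (if S zero then v zero else zeroV) ⊕ sumVecs f (λ j → S (suc j)) (λ j → v (suc j))

  sign : (f : ℕ) → (Fin f → Bool) → Carrier
  sign f S = prodFin f (λ j → if S j then 1# else - 1#)

  toBool : Fin 2 → Bool
  toBool zero = false
  toBool (suc _) = true

  assocForm : ∀ {n} (f : ℕ) → (invf! : Carrier) → (Vect n → Carrier)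
            → (Fin f → Vect n) → Carrier
  assocForm f invf! h v =
    invf! * sumTuples f 2 (λ S → sign f (λ j → toBool (S j))
                              * h (sumVecs f (λ j → toBool (S j)) v))

  Regular : ∀ {n} (f : ℕ) → .{{_ : NonZero f}} → (invf! : Carrier)
          → (Vect n → Carrier) → Set (c ⊔ ℓ)
  Regular {n} (suc g) invf! h =
    ∀ (v₁ : Vect n) →
      (∀ (vs : Fin g → Vect n) → assocForm (suc g) invf! h (v₁ ∷ vs) ≈ 0#) →
      ∀ i → v₁ i ≈ 0#

  -- The f-ic form h of Lemma 5.5 on K^{l-1}.
  -- Coordinates of x ∈ K^{l-1} are x_1,…,x_{l-1}; x_0 = 0.

  coord : ∀ {m} → Vect m → Fin (suc m) → Carrier
  coord x zero    = 0#
  coord x (suc i) = x i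

  weight : (f l β : ℕ) → (Fin f → Fin l) → ℕ
  weight zero    l β t = 0
  weight (suc f) l β t = toℕ (t zero) ℕ.+ β ℕ.* weight f l β (λ j → t (suc j))

  formH : (f m β γ : ℕ) → Vect m → Carrier
  formH f m β γ x =
      sumTuples f (suc m) (λ t →
        if ⌊ weight f (suc m) β t % suc m ≟ 0 ⌋
        then prodFin f (λ k → coord x (t k)) else 0#)
    - sumTuples f (suc m) (λ t →
        if ⌊ weight f (suc m) β t % suc m ≟ γ % suc m ⌋
        then prodFin f (λ k → coord x (t k)) else 0#)

module Submission where

-- A vector x ∈ K ^ (l - 1) is read as the element Σ_j x_j T ^ j (with x_0 = 0) of the group
-- ring K[ℤ/lℤ] = K[T]/(T ^ l - 1). Polarizing h along (x, e_J, …, e_J) and taking an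
-- (f - 1)-st finite difference shows that θ_h(x, e_J, …, e_J) = ((f - 1)! / f!) [T ^ J] (x ⋆ P),
-- where P = Σ_v Σ_{p<f} ([v s_p ≡ 0] - [v s_p ≡ γ]) T ^ v and s_p = Σ_{k≠p} β ^ k ≡ -β ^ p.
-- So if x lies in the radical of θ_h, then x ⋆ P = 0 (its constant coefficient vanishes too,
-- as Σ P = 0). Irreducibility of Φ_l makes K[ℤ/lℤ]/(N), N = Σ_j T ^ j, the field K(ζ_l).
-- P is not a multiple of N (Σ P = 0 but P_0 = f ≠ 0), so neither are its conjugates under the
-- automorphisms T ↦ T ^ (γ ^ k), nor their product M, the norm of P. As M is fixed by
-- T ↦ T ^ γ, M = c N + d with d ≠ 0, and 0 = x ⋆ M = c (Σ x) N + d x with x_0 = 0 gives x = 0.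

open import Defs
open import Level using (Level; _⊔_)
import Algebra.Properties.AbelianGroup as AbelianGroupProperties
import Algebra.Properties.CommutativeSemigroup as CommutativeSemigroupProperties
import Algebra.Properties.Ring as RingProperties
import Algebra.Properties.Semiring.Sum as SemiringSum
import Algebra.Solver.Ring
import Algebra.Solver.Ring.AlmostCommutativeRing as ACR
open import Data.Bool using (Bool; true; false; if_then_else_)
open import Data.Empty using (⊥; ⊥-elim)
open import Data.Fin as Fin using (Fin; zero; suc; toℕ; fromℕ<; punchIn)
import Data.Fin.Properties as Fin
open import Data.Integer as ℤ using (ℤ; +_; -[1+_]; _⊖_)
import Data.Integer.Properties as ℤ
open import Data.Maybe using (Maybe; just; nothing)
open import Data.Nat as ℕ using (ℕ; zero; suc; _!; _%_; _∸_; _≤_; _<_; _≟_; _<?_; _≤?_; z≤n; s≤s; NonZero)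
import Data.Nat as Nat
import Data.Nat.Properties as ℕₚ
open import Data.Nat.DivMod using (_/_; %-distribˡ-+; %-distribˡ-*; m%n%n≡m%n; n%n≡0; m%n<n; m%n≤n; m<n⇒m%n≡m; m≡m%n+[m/n]*n)
open import Data.Nat.Divisibility using (_∣_; m%n≡0⇒n∣m; n∣m⇒m%n≡0; ∣1⇒≡1)
open import Data.Nat.Primality using (Prime; euclidsLemma; prime⇒nonZero; ¬prime[0]; ¬prime[1])
open import Data.Nat.Tactic.RingSolver using (solve-∀)
open import Data.Product using (∃-syntax; _×_; _,_; proj₁; proj₂)
open import Data.Sum using (_⊎_; inj₁; inj₂; [_,_]′)
open import Data.Vec.Functional using (_∷_; updateAt)
import Data.Vec.Functional.Relation.Binary.Equality.Setoid as PointwiseEquality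
open import Function using (_∘_)
open import Relation.Binary using (Setoid; IsEquivalence)
open import Relation.Binary.PropositionalEquality as ≡ using (_≡_; _≢_)
import Relation.Binary.Reasoning.Setoid as SetoidReasoning
open import Relation.Nullary using (¬_; Dec; yes; no)
open import Relation.Nullary.Decidable using (⌊_⌋; ¬¬-excluded-middle)
open import Relation.Nullary.Negation using (contradiction)

module Residues (m : ℕ) where

  open Nat using (_+_; _*_; _^_)
  open ℕₚ
  open ≡ using (refl; cong; cong₂; subst)
  open CommutativeSemigroupProperties +-commutativeSemigroup using () renaming (x∙yz≈y∙xz to m+[n+o]≡n+[m+o])

  l : ℕ
  l = suc m

  infix 4 _≋_
  record _≋_ (a b : ℕ) : Set where
    constructor mk≋
    field %-≡ : a % l ≡ b % l
  open _≋_ public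

  ≋-isEquivalence : IsEquivalence _≋_
  ≋-isEquivalence = record
    { refl  = mk≋ refl
    ; sym   = λ (mk≋ e) → mk≋ (≡.sym e)
    ; trans = λ (mk≋ e) (mk≋ e′) → mk≋ (≡.trans e e′)
    }

  ≋-setoid : Setoid _ _
  ≋-setoid = record { isEquivalence = ≋-isEquivalence }

  open IsEquivalence ≋-isEquivalence public
    using () renaming (refl to ≋-refl; sym to ≋-sym; trans to ≋-trans; reflexive to ≡⇒≋)

  module ≋-Reasoning = SetoidReasoning ≋-setoid

  ≋-+ : ∀ {a a′ b b′} → a ≋ a′ → b ≋ b′ → a + b ≋ a′ + b′
  ≋-+ {a} {a′} {b} {b′} (mk≋ e) (mk≋ e′) = mk≋ (begin
    (a + b) % l           ≡⟨ %-distribˡ-+ a b l ⟩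
    (a % l + b % l) % l   ≡⟨ cong₂ (λ x y → (x + y) % l) e e′ ⟩
    (a′ % l + b′ % l) % l ≡⟨ %-distribˡ-+ a′ b′ l ⟨
    (a′ + b′) % l         ∎)
    where open ≡.≡-Reasoning

  ≋-* : ∀ {a a′ b b′} → a ≋ a′ → b ≋ b′ → a * b ≋ a′ * b′
  ≋-* {a} {a′} {b} {b′} (mk≋ e) (mk≋ e′) = mk≋ (begin
    (a * b) % l           ≡⟨ %-distribˡ-* a b l ⟩
    (a % l * (b % l)) % l ≡⟨ cong₂ (λ x y → (x * y) % l) e e′ ⟩
    (a′ % l * (b′ % l)) % l ≡⟨ %-distribˡ-* a′ b′ l ⟨
    (a′ * b′) % l         ∎)
    where open ≡.≡-Reasoning

  ≋-^ : ∀ {a b} k → a ≋ b → a ^ k ≋ b ^ k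
  ≋-^ zero    e = ≋-refl
  ≋-^ (suc k) e = ≋-* e (≋-^ k e)

  %-≋ : ∀ a → a % l ≋ a
  %-≋ a = mk≋ (m%n%n≡m%n a l)

  l≋0 : l ≋ 0
  l≋0 = mk≋ (n%n≡0 l)

  ≋0⇒∣ : ∀ {a} → a ≋ 0 → l ∣ a
  ≋0⇒∣ (mk≋ e) = m%n≡0⇒n∣m _ l e

  ∣⇒≋0 : ∀ {a} → l ∣ a → a ≋ 0
  ∣⇒≋0 d = mk≋ (n∣m⇒m%n≡0 _ l d)

  -ₗ_ : ℕ → ℕ
  -ₗ a = l ∸ a % l

  +-inverseʳ-≋ : ∀ a → a + -ₗ a ≋ 0
  +-inverseʳ-≋ a = begin
    a + -ₗ a     ≈⟨ ≋-+ (%-≋ a) ≋-refl ⟨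
    a % l + -ₗ a ≡⟨ m+[n∸m]≡n (m%n≤n a l) ⟩
    l            ≈⟨ l≋0 ⟩
    0            ∎
    where open ≋-Reasoning

  ≋-cancelˡ-+ : ∀ a {b c} → a + b ≋ a + c → b ≋ c
  ≋-cancelˡ-+ a {b} {c} e = begin
    b                ≡⟨ +-identityʳ b ⟨
    b + 0            ≈⟨ ≋-+ (≋-refl {b}) (+-inverseʳ-≋ a) ⟨
    b + (a + -ₗ a)   ≡⟨ shuffle b ⟩
    (a + b) + -ₗ a   ≈⟨ ≋-+ e ≋-refl ⟩
    (a + c) + -ₗ a   ≡⟨ shuffle c ⟨
    c + (a + -ₗ a)   ≈⟨ ≋-+ (≋-refl {c}) (+-inverseʳ-≋ a) ⟩
    c + 0            ≡⟨ +-identityʳ c ⟩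
    c                ∎
    where
    open ≋-Reasoning
    shuffle : ∀ x → x + (a + -ₗ a) ≡ (a + x) + -ₗ a
    shuffle x = ≡.trans (m+[n+o]≡n+[m+o] x a (-ₗ a)) (≡.sym (+-assoc a x (-ₗ a)))

  mod : ℕ → Fin l
  mod a = fromℕ< (m%n<n a l)

  toℕ-mod : ∀ a → toℕ (mod a) ≡ a % l
  toℕ-mod a = Fin.toℕ-fromℕ< (m%n<n a l)

  mod-≋ : ∀ a → toℕ (mod a) ≋ a
  mod-≋ a = ≋-trans (≡⇒≋ (toℕ-mod a)) (%-≋ a)

  toℕ-% : ∀ (j : Fin l) → toℕ j % l ≡ toℕ j
  toℕ-% j = m<n⇒m%n≡m (Fin.toℕ<n j)

  ≋⇒%≡toℕ : ∀ {a} {j : Fin l} → a ≋ toℕ j → a % l ≡ toℕ j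
  ≋⇒%≡toℕ {j = j} (mk≋ e) = ≡.trans e (toℕ-% j)

  <l-≋-injective : ∀ {a b} → a < l → b < l → a ≋ b → a ≡ b
  <l-≋-injective a<l b<l (mk≋ e) = ≡.trans (≡.sym (m<n⇒m%n≡m a<l)) (≡.trans e (m<n⇒m%n≡m b<l))

  toℕ-≋-injective : ∀ {i j : Fin l} → toℕ i ≋ toℕ j → i ≡ j
  toℕ-≋-injective {i} e = Fin.toℕ-injective (≡.trans (≡.sym (toℕ-% i)) (≋⇒%≡toℕ e))

  mod-cong : ∀ {a b} → a ≋ b → mod a ≡ mod b
  mod-cong e = toℕ-≋-injective (≋-trans (mod-≋ _) (≋-trans e (≋-sym (mod-≋ _))))

  mod-toℕ : ∀ (j : Fin l) → mod (toℕ j) ≡ j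
  mod-toℕ j = toℕ-≋-injective (mod-≋ (toℕ j))

  mod-< : ∀ {a} → a < l → toℕ (mod a) ≡ a
  mod-< {a} a<l = ≡.trans (toℕ-mod a) (m<n⇒m%n≡m a<l)

  ∃-+-≋ : ∀ a (j : Fin l) → ∃[ b ] (a + toℕ b ≋ toℕ j)
  ∃-+-≋ a j = mod (toℕ j + -ₗ a) , (begin
    a + toℕ (mod (toℕ j + -ₗ a)) ≈⟨ ≋-+ (≋-refl {a}) (mod-≋ _) ⟩
    a + (toℕ j + -ₗ a)           ≡⟨ m+[n+o]≡n+[m+o] a (toℕ j) (-ₗ a) ⟩
    toℕ j + (a + -ₗ a)           ≈⟨ ≋-+ (≋-refl {toℕ j}) (+-inverseʳ-≋ a) ⟩
    toℕ j + 0                    ≡⟨ +-identityʳ _ ⟩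
    toℕ j                        ∎)
    where open ≋-Reasoning

  module _ (l-prime : Prime l) where

    Unit : ℕ → Set
    Unit a = ¬ a ≋ 0

    1-unit : Unit 1
    1-unit e = ¬prime[1] (subst Prime (∣1⇒≡1 (≋0⇒∣ e)) l-prime)

    unit-* : ∀ {u v} → Unit u → Unit v → Unit (u * v)
    unit-* {u} {v} u-unit v-unit uv≋0 with euclidsLemma u v l-prime (≋0⇒∣ uv≋0)
    ... | inj₁ l∣u = u-unit (∣⇒≋0 l∣u)
    ... | inj₂ l∣v = v-unit (∣⇒≋0 l∣v)

    unit-^ : ∀ {u} k → Unit u → Unit (u ^ k)
    unit-^ zero    _      = 1-unit
    unit-^ (suc k) u-unit = unit-* u-unit (unit-^ k u-unit)

    private
      ≋-cancelˡ-*-≤ : ∀ {u a b} → Unit u → a ≤ b → u * a ≋ u * b → a ≋ b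
      ≋-cancelˡ-*-≤ {u} {a} {b} u-unit a≤b e = ≋-sym (begin
        b             ≡⟨ m+[n∸m]≡n a≤b ⟨
        a + (b ∸ a)   ≈⟨ ≋-+ (≋-refl {a}) d≋0 ⟩
        a + 0         ≡⟨ +-identityʳ a ⟩
        a             ∎)
        where
        open ≋-Reasoning
        ud≋0 : u * (b ∸ a) ≋ 0
        ud≋0 = ≋-sym (≋-cancelˡ-+ (u * a) (begin
          u * a + 0           ≡⟨ +-identityʳ _ ⟩
          u * a               ≈⟨ e ⟩
          u * b               ≡⟨ cong (u *_) (m+[n∸m]≡n a≤b) ⟨
          u * (a + (b ∸ a))   ≡⟨ *-distribˡ-+ u a _ ⟩
          u * a + u * (b ∸ a) ∎))
        d≋0 : b ∸ a ≋ 0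
        d≋0 with euclidsLemma u (b ∸ a) l-prime (≋0⇒∣ ud≋0)
        ... | inj₁ l∣u = ⊥-elim (u-unit (∣⇒≋0 l∣u))
        ... | inj₂ l∣d = ∣⇒≋0 l∣d

    ≋-cancelˡ-* : ∀ {u a b} → Unit u → u * a ≋ u * b → a ≋ b
    ≋-cancelˡ-* {a = a} {b} u-unit e with ≤-total a b
    ... | inj₁ a≤b = ≋-cancelˡ-*-≤ u-unit a≤b e
    ... | inj₂ b≤a = ≋-sym (≋-cancelˡ-*-≤ u-unit b≤a (≋-sym e))

module Generator (m : ℕ) (m≥2 : 2 ≤ m) (l-prime : Prime (suc m))
                 (γ : ℕ) (generator : IsGeneratorMod (suc m) γ) where

  open Nat using (_+_; _*_; _^_)
  open ℕₚ
  open ≡ using (refl; cong; subst)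
  open Residues m
  open ≋-Reasoning

  m≥1 : 1 ≤ m
  m≥1 = ≤-trans (s≤s z≤n) m≥2

  <l-unit : ∀ {a} → 0 < a → a < l → Unit l-prime a
  <l-unit 0<a a<l a≋0 = <⇒≢ 0<a (≡.sym (<l-≋-injective a<l (s≤s z≤n) a≋0))

  discreteLog : ∀ {a} → Unit l-prime a → ∃[ k ] (γ ^ k ≋ a)
  discreteLog {a} a-unit = let k , e = generator a (a-unit ∘ mk≋) in k , mk≋ e

  -- γ ≋ 0 would leave no power of γ congruent to 2
  γ-unit : Unit l-prime γ
  γ-unit γ≋0 with discreteLog (<l-unit {2} (s≤s z≤n) (s≤s m≥2))
  ... | zero  , 1≋2 = <⇒≢ (≤-refl {2}) (<l-≋-injective (s≤s m≥1) (s≤s m≥2) 1≋2)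
  ... | suc k , γ^k≋2 = <l-unit {2} (s≤s z≤n) (s≤s m≥2) (≋-trans (≋-sym γ^k≋2) (≋-* γ≋0 (≋-refl {γ ^ k})))

  ^-≋-% : ∀ d .{{_ : NonZero d}} → γ ^ d ≋ 1 → ∀ k → γ ^ k ≋ γ ^ (k % d)
  ^-≋-% d γ^d≋1 k = begin
    γ ^ k                           ≡⟨ cong (γ ^_) (m≡m%n+[m/n]*n k d) ⟩
    γ ^ (k % d + k / d * d)         ≡⟨ ^-distribˡ-+-* γ (k % d) _ ⟩
    γ ^ (k % d) * γ ^ (k / d * d)   ≡⟨ cong (λ n → γ ^ (k % d) * γ ^ n) (*-comm (k / d) d) ⟩
    γ ^ (k % d) * γ ^ (d * (k / d)) ≡⟨ cong (γ ^ (k % d) *_) (^-*-assoc γ d (k / d)) ⟨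
    γ ^ (k % d) * (γ ^ d) ^ (k / d) ≈⟨ ≋-* (≋-refl {γ ^ (k % d)}) (≋-^ (k / d) γ^d≋1) ⟩
    γ ^ (k % d) * 1 ^ (k / d)       ≡⟨ cong (γ ^ (k % d) *_) (^-zeroˡ (k / d)) ⟩
    γ ^ (k % d) * 1                 ≡⟨ *-identityʳ _ ⟩
    γ ^ (k % d)                     ∎

  -- the powers γ ^ (log (1 + a)) for a < m are pairwise incongruent, and
  -- modulo an exponent d with γ ^ d ≋ 1 they take at most d values
  order-≥ : ∀ d → 1 ≤ d → γ ^ d ≋ 1 → m ≤ d
  order-≥ d@(suc _) _ γ^d≋1 = Fin.injective⇒≤ ψ-injective
    where
    unit : ∀ (a : Fin m) → Unit l-prime (suc (toℕ a))
    unit a = <l-unit (s≤s z≤n) (s≤s (Fin.toℕ<n a))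
    log : Fin m → ℕ
    log a = proj₁ (discreteLog (unit a))
    ψ : Fin m → Fin d
    ψ a = fromℕ< (m%n<n (log a) d)
    ψ-injective : ∀ {a b} → ψ a ≡ ψ b → a ≡ b
    ψ-injective {a} {b} ψa≡ψb = Fin.toℕ-injective (suc-injective
      (<l-≋-injective (s≤s (Fin.toℕ<n a)) (s≤s (Fin.toℕ<n b)) (begin
        suc (toℕ a)        ≈⟨ proj₂ (discreteLog (unit a)) ⟨
        γ ^ log a          ≈⟨ ^-≋-% d γ^d≋1 (log a) ⟩
        γ ^ (log a % d)    ≡⟨ cong (γ ^_) log%d-≡ ⟩
        γ ^ (log b % d)    ≈⟨ ^-≋-% d γ^d≋1 (log b) ⟨
        γ ^ log b          ≈⟨ proj₂ (discreteLog (unit b)) ⟩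
        suc (toℕ b)        ∎)))
      where
      log%d-≡ : log a % d ≡ log b % d
      log%d-≡ = ≡.trans (≡.sym (Fin.toℕ-fromℕ< _)) (≡.trans (cong toℕ ψa≡ψb) (Fin.toℕ-fromℕ< _))

  γ^k%l≥1 : ∀ k → 1 ≤ γ ^ k % l
  γ^k%l≥1 k = n≢0⇒n>0 (unit-^ l-prime k γ-unit ∘ mk≋)

  -- pigeonhole on the residues of γ ^ 0, …, γ ^ m, which all lie in 1 … m
  order-exists : ∃[ d ] (1 ≤ d × d ≤ m × γ ^ d ≋ 1)
  order-exists with Fin.pigeonhole (n<1+n m) φ
    where
    φ : Fin l → Fin m
    φ k = fromℕ< (∸-monoˡ-< (m%n<n (γ ^ toℕ k) l) (γ^k%l≥1 (toℕ k)))
  ... | i , j , i<j , φi≡φj =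
    toℕ j ∸ toℕ i , m<n⇒0<n∸m i<j , d≤m , ≋-cancelˡ-* l-prime (unit-^ l-prime (toℕ i) γ-unit) (begin
    γ ^ toℕ i * γ ^ d   ≡⟨ ^-distribˡ-+-* γ (toℕ i) d ⟨
    γ ^ (toℕ i + d)     ≡⟨ cong (γ ^_) (m+[n∸m]≡n (<⇒≤ i<j)) ⟩
    γ ^ toℕ j           ≈⟨ mk≋ residues-≡ ⟨
    γ ^ toℕ i           ≡⟨ *-identityʳ _ ⟨
    γ ^ toℕ i * 1       ∎)
    where
    d = toℕ j ∸ toℕ i
    d≤m : d ≤ m
    d≤m = ≤-trans (m∸n≤m (toℕ j) (toℕ i)) (≤-pred (Fin.toℕ<n j))
    residues-≡ : γ ^ toℕ i % l ≡ γ ^ toℕ j % l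
    residues-≡ = ∸-cancelʳ-≡ (γ^k%l≥1 (toℕ i)) (γ^k%l≥1 (toℕ j))
      (≡.trans (≡.sym (Fin.toℕ-fromℕ< _)) (≡.trans (cong toℕ φi≡φj) (Fin.toℕ-fromℕ< _)))

  γ^m≋1 : γ ^ m ≋ 1
  γ^m≋1 = let d , 1≤d , d≤m , γ^d≋1 = order-exists in
    subst (λ n → γ ^ n ≋ 1) (≤-antisym d≤m (order-≥ d 1≤d γ^d≋1)) γ^d≋1

  fermat : ∀ {s} → Unit l-prime s → s ^ m ≋ 1
  fermat {s} s-unit with discreteLog s-unit
  ... | k , γ^k≋s = begin
    s ^ m         ≈⟨ ≋-^ m γ^k≋s ⟨
    (γ ^ k) ^ m   ≡⟨ ^-*-assoc γ k m ⟩
    γ ^ (k * m)   ≡⟨ cong (γ ^_) (*-comm k m) ⟩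
    γ ^ (m * k)   ≡⟨ ^-*-assoc γ m k ⟨
    (γ ^ m) ^ k   ≈⟨ ≋-^ k γ^m≋1 ⟩
    1 ^ k         ≡⟨ ^-zeroˡ k ⟩
    1             ∎

  ∃-*-≋ : ∀ {s} → Unit l-prime s → ∀ c → ∃[ v ] (toℕ v * s ≋ c)
  ∃-*-≋ {s} s-unit c = mod (c * s ^ (m ∸ 1)) , (begin
    toℕ (mod (c * s ^ (m ∸ 1))) * s ≈⟨ ≋-* (mod-≋ (c * s ^ (m ∸ 1))) (≋-refl {s}) ⟩
    c * s ^ (m ∸ 1) * s             ≡⟨ *-assoc c _ s ⟩
    c * (s ^ (m ∸ 1) * s)           ≡⟨ cong (c *_) (≡.trans (*-comm _ s) (cong (s ^_) (m+[n∸m]≡n m≥1))) ⟩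
    c * s ^ m                       ≈⟨ ≋-* (≋-refl {c}) (fermat s-unit) ⟩
    c * 1                           ≡⟨ *-identityʳ c ⟩
    c                               ∎)

  module GeometricSum (e f : ℕ) (m≡e*f : m ≡ e * f) (f≥2 : 2 ≤ f) where

    β : ℕ
    β = γ ^ e

    β-unit : Unit l-prime β
    β-unit = unit-^ l-prime e γ-unit

    β≥1 : 1 ≤ β
    β≥1 = n≢0⇒n>0 (β-unit ∘ ≡⇒≋)

    β^f≋1 : β ^ f ≋ 1
    β^f≋1 = ≋-trans (≡⇒≋ (≡.trans (^-*-assoc γ e f) (cong (γ ^_) (≡.sym m≡e*f)))) γ^m≋1

    β≉1 : ¬ β ≋ 1
    β≉1 β≋1 = <⇒≱ e<m (order-≥ e 1≤e β≋1)
      where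
      1≤e : 1 ≤ e
      1≤e = n≢0⇒n>0 λ { refl → <⇒≢ m≥1 (≡.sym m≡e*f) }
      e<m : e < m
      e<m = subst (e <_) (≡.sym m≡e*f) (m<m*n e f f≥2)
        where instance _ = ℕ.>-nonZero 1≤e

    geom : ℕ → ℕ
    geom zero    = 0
    geom (suc n) = 1 + β * geom n

    geomExcept : (n : ℕ) → Fin n → ℕ
    geomExcept (suc n) zero    = β * geom n
    geomExcept (suc n) (suc p) = 1 + β * geomExcept n p

    geomExcept+β^p : ∀ n p → geomExcept n p + β ^ toℕ p ≡ geom n
    geomExcept+β^p (suc n) zero    = +-comm (β * geom n) 1
    geomExcept+β^p (suc n) (suc p) = ≡.trans
      (≡.trans (+-assoc 1 (β * geomExcept n p) (β * β ^ toℕ p)) (cong suc (≡.sym (*-distribˡ-+ β (geomExcept n p) (β ^ toℕ p)))))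
      (cong (λ x → 1 + β * x) (geomExcept+β^p n p))

    geom-suc : ∀ n → geom (suc n) ≡ geom n + β ^ n
    geom-suc zero    = cong suc (*-zeroʳ β)
    geom-suc (suc n) = ≡.trans (cong (λ x → 1 + β * x) (geom-suc n))
      (≡.trans (cong suc (*-distribˡ-+ β (geom n) _)) (≡.sym (+-assoc 1 (β * geom n) (β * β ^ n))))

    β*geom≋geom : β * geom f ≋ geom f
    β*geom≋geom = ≋-cancelˡ-+ 1 (begin
      1 + β * geom f   ≡⟨ geom-suc f ⟩
      geom f + β ^ f   ≈⟨ ≋-+ (≋-refl {geom f}) β^f≋1 ⟩
      geom f + 1       ≡⟨ +-comm (geom f) 1 ⟩
      1 + geom f       ∎)

    [β∸1]*geom≋0 : (β ∸ 1) * geom f ≋ 0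
    [β∸1]*geom≋0 = ≋-cancelˡ-+ (geom f) (begin
      geom f + (β ∸ 1) * geom f ≡⟨ cong (_* geom f) (m+[n∸m]≡n β≥1) ⟩
      β * geom f                ≈⟨ β*geom≋geom ⟩
      geom f                    ≡⟨ +-identityʳ (geom f) ⟨
      geom f + 0                ∎)

    geom-≋0 : geom f ≋ 0
    geom-≋0 = [ (λ l∣β∸1 → ⊥-elim (β≉1 (β≋1 l∣β∸1))) , ∣⇒≋0 ]′
      (euclidsLemma (β ∸ 1) (geom f) l-prime (≋0⇒∣ [β∸1]*geom≋0))
      where
      β≋1 : l ∣ β ∸ 1 → β ≋ 1
      β≋1 l∣β∸1 = ≋-trans (≡⇒≋ (≡.sym (m+[n∸m]≡n β≥1))) (≋-+ (≋-refl {1}) (∣⇒≋0 l∣β∸1))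

    geomExcept-unit : ∀ p → Unit l-prime (geomExcept f p)
    geomExcept-unit p g≋0 = unit-^ l-prime (toℕ p) β-unit (begin
      β ^ toℕ p                   ≈⟨ ≋-+ g≋0 (≋-refl {β ^ toℕ p}) ⟨
      geomExcept f p + β ^ toℕ p  ≡⟨ geomExcept+β^p f p ⟩
      geom f                      ≈⟨ geom-≋0 ⟩
      0                           ∎)

module FieldBasics {c ℓ} (K : Field c ℓ) where

  open Field K hiding (zero)
  open FieldStuff K
  open RingProperties ring public
    using (-0#≈0#; -‿involutive; -‿+-comm; -‿distribˡ-*; -‿distribʳ-*; -1*x≈-x; [y-z]x≈yx-zx)
    renaming (x∙y⁻¹≈ε⇒x≈y to x-y≈0⇒x≈y)
  open SetoidReasoning setoid
  open AbelianGroupProperties +-abelianGroup using (xyx⁻¹≈y)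

  ι-+ : ∀ m n → ι (m ℕ.+ n) ≈ ι m + ι n
  ι-+ zero    n = sym (+-identityˡ _)
  ι-+ (suc m) n = trans (+-congˡ (ι-+ m n)) (sym (+-assoc _ _ _))

  ι-* : ∀ m n → ι (m ℕ.* n) ≈ ι m * ι n
  ι-* zero    n = sym (zeroˡ _)
  ι-* (suc m) n = begin
    ι (n ℕ.+ m ℕ.* n)    ≈⟨ ι-+ n (m ℕ.* n) ⟩
    ι n + ι (m ℕ.* n)    ≈⟨ +-cong (sym (*-identityˡ _)) (ι-* m n) ⟩
    1# * ι n + ι m * ι n ≈⟨ distribʳ _ _ _ ⟨
    (1# + ι m) * ι n     ∎

  private
    ⟦_⟧ : ℤ → Carrier
    ⟦ + n      ⟧ = ι n
    ⟦ -[1+ n ] ⟧ = - ι (suc n)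

    ⟦-⟧ : ∀ i → ⟦ ℤ.- i ⟧ ≈ - ⟦ i ⟧
    ⟦-⟧ (+ zero)  = sym -0#≈0#
    ⟦-⟧ (+ suc n) = refl
    ⟦-⟧ -[1+ n ]  = sym (-‿involutive _)

    ⟦⊖⟧ : ∀ m n → ⟦ m ⊖ n ⟧ ≈ ι m - ι n
    ⟦⊖⟧ zero    zero    = sym (-‿inverseʳ 0#)
    ⟦⊖⟧ zero    (suc n) = sym (+-identityˡ _)
    ⟦⊖⟧ (suc m) zero    = sym (trans (+-congˡ -0#≈0#) (+-identityʳ _))
    ⟦⊖⟧ (suc m) (suc n) = begin
      ⟦ suc m ⊖ suc n ⟧             ≡⟨ ≡.cong ⟦_⟧ (ℤ.[1+m]⊖[1+n]≡m⊖n m n) ⟩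
      ⟦ m ⊖ n ⟧                     ≈⟨ ⟦⊖⟧ m n ⟩
      ι m - ι n                     ≈⟨ +-congʳ (xyx⁻¹≈y 1# (ι m)) ⟨
      1# + ι m + - 1# + - ι n       ≈⟨ +-assoc _ _ _ ⟩
      (1# + ι m) + (- 1# + - ι n)   ≈⟨ +-congˡ (-‿+-comm 1# (ι n)) ⟩
      ι (suc m) - ι (suc n)         ∎

    ⟦+⟧ : ∀ i j → ⟦ i ℤ.+ j ⟧ ≈ ⟦ i ⟧ + ⟦ j ⟧
    ⟦+⟧ -[1+ m ] -[1+ n ] = begin
      - ι (suc (suc (m ℕ.+ n)))    ≡⟨ ≡.cong (λ k → - ι k) (ℕₚ.+-suc (suc m) n) ⟨
      - ι (suc m ℕ.+ suc n)        ≈⟨ -‿cong (ι-+ (suc m) (suc n)) ⟩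
      - (ι (suc m) + ι (suc n))    ≈⟨ -‿+-comm _ _ ⟨
      - ι (suc m) + - ι (suc n)    ∎
    ⟦+⟧ -[1+ m ] (+ n)    = trans (⟦⊖⟧ n (suc m)) (+-comm _ _)
    ⟦+⟧ (+ m)    -[1+ n ] = ⟦⊖⟧ m (suc n)
    ⟦+⟧ (+ m)    (+ n)    = ι-+ m n

    ⟦*⟧ : ∀ i j → ⟦ i ℤ.* j ⟧ ≈ ⟦ i ⟧ * ⟦ j ⟧
    ⟦*⟧ (+ m) (+ n) = begin
      ⟦ ℤ.+ m ℤ.* ℤ.+ n ⟧ ≡⟨ ≡.cong ⟦_⟧ (ℤ.+◃n≡+n (m ℕ.* n)) ⟩
      ι (m ℕ.* n)         ≈⟨ ι-* m n ⟩
      ι m * ι n           ∎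
    ⟦*⟧ (+ m) -[1+ n ] = begin
      ⟦ ℤ.+ m ℤ.* -[1+ n ] ⟧          ≡⟨ ≡.cong ⟦_⟧ (ℤ.-◃n≡-n (m ℕ.* suc n)) ⟩
      ⟦ ℤ.- (ℤ.+ (m ℕ.* suc n)) ⟧     ≈⟨ ⟦-⟧ (ℤ.+ (m ℕ.* suc n)) ⟩
      - ι (m ℕ.* suc n)               ≈⟨ -‿cong (ι-* m (suc n)) ⟩
      - (ι m * ι (suc n))             ≈⟨ -‿distribʳ-* _ _ ⟩
      ι m * - ι (suc n)               ∎
    ⟦*⟧ -[1+ m ] (+ n) = begin
      ⟦ -[1+ m ] ℤ.* ℤ.+ n ⟧          ≡⟨ ≡.cong ⟦_⟧ (ℤ.-◃n≡-n (suc m ℕ.* n)) ⟩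
      ⟦ ℤ.- (ℤ.+ (suc m ℕ.* n)) ⟧     ≈⟨ ⟦-⟧ (ℤ.+ (suc m ℕ.* n)) ⟩
      - ι (suc m ℕ.* n)               ≈⟨ -‿cong (ι-* (suc m) n) ⟩
      - (ι (suc m) * ι n)             ≈⟨ -‿distribˡ-* _ _ ⟩
      - ι (suc m) * ι n               ∎
    ⟦*⟧ -[1+ m ] -[1+ n ] = begin
      ι (suc m ℕ.* suc n)             ≈⟨ ι-* (suc m) (suc n) ⟩
      ι (suc m) * ι (suc n)           ≈⟨ -‿involutive _ ⟨
      - - (ι (suc m) * ι (suc n))     ≈⟨ -‿cong (-‿distribʳ-* _ _) ⟩
      - (ι (suc m) * - ι (suc n))     ≈⟨ -‿distribˡ-* _ _ ⟩
      - ι (suc m) * - ι (suc n)       ∎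

    -- the coefficient map used by the solver sends 1 to 1# on the nose, so
    -- that a constant 1 in a goal is matched definitionally
    ι′ : ℕ → Carrier
    ι′ zero          = 0#
    ι′ (suc zero)    = 1#
    ι′ (suc (suc n)) = 1# + ι′ (suc n)

    ι′≈ι : ∀ n → ι′ n ≈ ι n
    ι′≈ι zero          = refl
    ι′≈ι (suc zero)    = sym (+-identityʳ 1#)
    ι′≈ι (suc (suc n)) = +-congˡ (ι′≈ι (suc n))

    ⟦_⟧′ : ℤ → Carrier
    ⟦ + n      ⟧′ = ι′ n
    ⟦ -[1+ n ] ⟧′ = - ι′ (suc n)

    ⟦⟧′≈⟦⟧ : ∀ i → ⟦ i ⟧′ ≈ ⟦ i ⟧
    ⟦⟧′≈⟦⟧ (+ n)      = ι′≈ι n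
    ⟦⟧′≈⟦⟧ -[1+ n ]   = -‿cong (ι′≈ι (suc n))

    ℤ⟶K : ℤ.+-*-rawRing ACR.-Raw-AlmostCommutative⟶ ACR.fromCommutativeRing commutativeRing
    ℤ⟶K = record
      { ⟦_⟧    = ⟦_⟧′
      ; +-homo = λ i j → transport (i ℤ.+ j) (⟦+⟧ i j) (+-cong (⟦⟧′≈⟦⟧ i) (⟦⟧′≈⟦⟧ j))
      ; *-homo = λ i j → transport (i ℤ.* j) (⟦*⟧ i j) (*-cong (⟦⟧′≈⟦⟧ i) (⟦⟧′≈⟦⟧ j))
      ; -‿homo = λ i → transport (ℤ.- i) (⟦-⟧ i) (-‿cong (⟦⟧′≈⟦⟧ i))
      ; 0-homo = refl
      ; 1-homo = refl
      }
      where
      transport : ∀ i {x y} → ⟦ i ⟧ ≈ x → y ≈ x → ⟦ i ⟧′ ≈ y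
      transport i ⟦i⟧≈x y≈x = trans (⟦⟧′≈⟦⟧ i) (trans ⟦i⟧≈x (sym y≈x))

    ≟-weak : ∀ i j → Maybe (⟦ i ⟧′ ≈ ⟦ j ⟧′)
    ≟-weak i j with i ℤ.≟ j
    ... | yes ≡.refl = just refl
    ... | no _       = nothing

  open Algebra.Solver.Ring ℤ.+-*-rawRing (ACR.fromCommutativeRing commutativeRing) ℤ⟶K ≟-weak public
    using (solve; _:=_; _:+_; _:*_; _:-_; :-_; con)

  x≉0∧x*y≈0⇒y≈0 : ∀ {x y} → ¬ x ≈ 0# → x * y ≈ 0# → y ≈ 0#
  x≉0∧x*y≈0⇒y≈0 {x} {y} x≉0 xy≈0 = let x⁻¹ , xx⁻¹≈1 = inverse x x≉0 in begin
    y               ≈⟨ *-identityˡ y ⟨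
    1# * y          ≈⟨ *-congʳ xx⁻¹≈1 ⟨
    (x * x⁻¹) * y   ≈⟨ solve 3 (λ x x⁻¹ y → (x :* x⁻¹) :* y := x⁻¹ :* (x :* y)) refl x x⁻¹ y ⟩
    x⁻¹ * (x * y)   ≈⟨ *-congˡ xy≈0 ⟩
    x⁻¹ * 0#        ≈⟨ zeroʳ x⁻¹ ⟩
    0#              ∎

  open SemiringSum semiring public
    using (sum; sum-cong-≋; sum-cong-≗; ∑-comm; *-distribˡ-sum; *-distribʳ-sum; sum-remove; sum-replicate-zero)
    renaming (∑-distrib-+ to sum-distrib-+)

  sum-zero : ∀ {n} {g : Fin n → Carrier} → (∀ i → g i ≈ 0#) → sum g ≈ 0#
  sum-zero {n} g≈0 = trans (sum-cong-≋ g≈0) (sum-replicate-zero n)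

  sum-single : ∀ {n} {g : Fin n → Carrier} a → (∀ i → i ≢ a → g i ≈ 0#) → sum g ≈ g a
  sum-single {suc n} {g} a g≈0 = begin
    sum g                          ≈⟨ sum-remove {i = a} g ⟩
    g a + sum (g ∘ punchIn a)      ≈⟨ +-congˡ (sum-zero (λ i → g≈0 _ (Fin.punchInᵢ≢i a i))) ⟩
    g a + 0#                       ≈⟨ +-identityʳ _ ⟩
    g a                            ∎

  sum-neg : ∀ {n} (g : Fin n → Carrier) → sum (λ i → - g i) ≈ - sum g
  sum-neg g = begin
    sum (λ i → - g i)       ≈⟨ sum-cong-≋ (λ i → -1*x≈-x (g i)) ⟨
    sum (λ i → - 1# * g i)  ≈⟨ *-distribˡ-sum (- 1#) g ⟨
    - 1# * sum g            ≈⟨ -1*x≈-x _ ⟩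
    - sum g                 ∎

  sum-distrib-- : ∀ {n} (g h : Fin n → Carrier) → sum (λ i → g i - h i) ≈ sum g - sum h
  sum-distrib-- g h = trans (sum-distrib-+ g (λ i → - h i)) (+-congˡ (sum-neg h))

  sumFin≡sum : ∀ n (g : Fin n → Carrier) → sumFin n g ≡ sum g
  sumFin≡sum zero    g = ≡.refl
  sumFin≡sum (suc n) g = ≡.cong (λ s → g zero + s) (sumFin≡sum n (g ∘ suc))

  prodFin-cong : ∀ n {g h : Fin n → Carrier} → (∀ i → g i ≈ h i) → prodFin n g ≈ prodFin n h
  prodFin-cong zero    g≈h = refl
  prodFin-cong (suc n) g≈h = *-cong (g≈h zero) (prodFin-cong n (g≈h ∘ suc))

  sumFin-cong : ∀ n {g h : Fin n → Carrier} → (∀ i → g i ≈ h i) → sumFin n g ≈ sumFin n h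
  sumFin-cong n {g} {h} g≈h = begin
    sumFin n g ≡⟨ sumFin≡sum n g ⟩
    sum g      ≈⟨ sum-cong-≋ g≈h ⟩
    sum h      ≡⟨ sumFin≡sum n h ⟨
    sumFin n h ∎

  sumFin-distrib-+ : ∀ n (g h : Fin n → Carrier) → sumFin n (λ i → g i + h i) ≈ sumFin n g + sumFin n h
  sumFin-distrib-+ n g h = begin
    sumFin n (λ i → g i + h i) ≡⟨ sumFin≡sum n _ ⟩
    sum (λ i → g i + h i)      ≈⟨ sum-distrib-+ g h ⟩
    sum g + sum h              ≡⟨ ≡.cong₂ _+_ (sumFin≡sum n g) (sumFin≡sum n h) ⟨
    sumFin n g + sumFin n h    ∎

  sumFin-neg : ∀ n (g : Fin n → Carrier) → sumFin n (λ i → - g i) ≈ - sumFin n g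
  sumFin-neg n g = begin
    sumFin n (λ i → - g i) ≡⟨ sumFin≡sum n _ ⟩
    sum (λ i → - g i)      ≈⟨ sum-neg g ⟩
    - sum g                ≡⟨ ≡.cong -_ (sumFin≡sum n g) ⟨
    - sumFin n g           ∎

  sumFin-zero : ∀ n {g : Fin n → Carrier} → (∀ i → g i ≈ 0#) → sumFin n g ≈ 0#
  sumFin-zero n {g} g≈0 = trans (reflexive (sumFin≡sum n g)) (sum-zero g≈0)

  sumFin-const : ∀ n x → sumFin n (λ _ → x) ≈ ι n * x
  sumFin-const zero    x = sym (zeroˡ x)
  sumFin-const (suc n) x = trans (+-cong (sym (*-identityˡ x)) (sumFin-const n x)) (sym (distribʳ x 1# (ι n)))

  *-distribʳ-sumFin : ∀ n x (g : Fin n → Carrier) → sumFin n g * x ≈ sumFin n (λ i → g i * x)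
  *-distribʳ-sumFin zero    x g = zeroˡ x
  *-distribʳ-sumFin (suc n) x g = trans (distribʳ x _ _) (+-congˡ (*-distribʳ-sumFin n x (g ∘ suc)))

  sumFin-truncate : ∀ n k (H : ℕ → Carrier) → k ℕ.< n →
    sumFin n (λ i → if ⌊ Fin.toℕ i ℕ.≤? k ⌋ then H (Fin.toℕ i) else 0#) ≈ sumFin (suc k) (H ∘ Fin.toℕ)
  sumFin-truncate (suc n) zero    H _ = +-congˡ (sumFin-zero n (λ _ → refl))
  sumFin-truncate (suc n) (suc k) H (ℕ.s≤s k<n) =
    +-congˡ (trans (sumFin-cong n (λ i → reflexive (≡.cong (λ b → if b then H (suc (Fin.toℕ i)) else 0#)
                                                            (≤?-suc (Fin.toℕ i) k))))
                   (sumFin-truncate n k (H ∘ suc) k<n))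
    where
    ≤?-suc : ∀ a b → ⌊ suc a ℕ.≤? suc b ⌋ ≡ ⌊ a ℕ.≤? b ⌋
    ≤?-suc a b with a ℕ.≤? b | suc a ℕ.≤? suc b
    ... | yes _   | yes _    = ≡.refl
    ... | no  _   | no  _    = ≡.refl
    ... | yes a≤b | no 1+a≰1+b = contradiction (ℕ.s≤s a≤b) 1+a≰1+b
    ... | no  a≰b | yes 1+a≤1+b = contradiction (ℕₚ.≤-pred 1+a≤1+b) a≰b

  module _ {n : ℕ} where

    sumTuples-cong : ∀ f {g h : (Fin f → Fin n) → Carrier} → (∀ t → g t ≈ h t) →
                     sumTuples f n g ≈ sumTuples f n h
    sumTuples-cong zero    g≈h = g≈h _
    sumTuples-cong (suc f) g≈h = sumFin-cong n (λ i → sumTuples-cong f (λ t → g≈h (i ∷ t)))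

    sumTuples-distrib-+ : ∀ f (g h : (Fin f → Fin n) → Carrier) →
      sumTuples f n (λ t → g t + h t) ≈ sumTuples f n g + sumTuples f n h
    sumTuples-distrib-+ zero    g h = refl
    sumTuples-distrib-+ (suc f) g h = trans (sumFin-cong n (λ i → sumTuples-distrib-+ f _ _)) (sumFin-distrib-+ n _ _)

    sumTuples-neg : ∀ f (g : (Fin f → Fin n) → Carrier) → sumTuples f n (λ t → - g t) ≈ - sumTuples f n g
    sumTuples-neg zero    g = refl
    sumTuples-neg (suc f) g = trans (sumFin-cong n (λ i → sumTuples-neg f _)) (sumFin-neg n _)

    sumTuples-distrib-- : ∀ f (g h : (Fin f → Fin n) → Carrier) →
      sumTuples f n (λ t → g t - h t) ≈ sumTuples f n g - sumTuples f n h
    sumTuples-distrib-- f g h = trans (sumTuples-distrib-+ f g _) (+-congˡ (sumTuples-neg f h))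

    *-distribˡ-sumTuples : ∀ f x (g : (Fin f → Fin n) → Carrier) →
      x * sumTuples f n g ≈ sumTuples f n (λ t → x * g t)
    *-distribˡ-sumTuples zero    x g = refl
    *-distribˡ-sumTuples (suc f) x g = begin
      x * sumFin n ∑G               ≡⟨ ≡.cong (x *_) (sumFin≡sum n ∑G) ⟩
      x * sum ∑G                    ≈⟨ *-distribˡ-sum x ∑G ⟩
      sum (λ i → x * ∑G i)          ≡⟨ sumFin≡sum n _ ⟨
      sumFin n (λ i → x * ∑G i)     ≈⟨ sumFin-cong n (λ i → *-distribˡ-sumTuples f x _) ⟩
      sumTuples (suc f) n (λ t → x * g t) ∎
      where
      ∑G : Fin n → Carrier
      ∑G i = sumTuples f n (λ t → g (i ∷ t))

module FiniteDifferences {c ℓ} (K : Field c ℓ) where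

  open Field K hiding (zero)
  open FieldStuff K
  open FieldBasics K
  open SetoidReasoning setoid

  Seq : Set c
  Seq = ℕ → Carrier

  infix 4 _≐_
  _≐_ : Seq → Seq → Set ℓ
  g ≐ h = ∀ x → g x ≈ h x

  Δ : Seq → Seq
  Δ g x = g (suc x) - g x

  Δ^ : ℕ → Seq → Seq
  Δ^ zero    g = g
  Δ^ (suc k) g = Δ^ k (Δ g)

  Δ^-cong : ∀ k {g h} → g ≐ h → Δ^ k g ≐ Δ^ k h
  Δ^-cong zero    g≐h = g≐h
  Δ^-cong (suc k) g≐h = Δ^-cong k (λ x → +-cong (g≐h (suc x)) (-‿cong (g≐h x)))

  Δ^-+ : ∀ k g h → Δ^ k (λ x → g x + h x) ≐ (λ x → Δ^ k g x + Δ^ k h x)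
  Δ^-+ zero    g h x = refl
  Δ^-+ (suc k) g h x = trans
    (Δ^-cong k (λ y → solve 4 (λ a b c d → (a :+ b) :- (c :+ d) := (a :- c) :+ (b :- d)) refl _ _ _ _) x)
    (Δ^-+ k (Δ g) (Δ h) x)

  Δ^-*ˡ : ∀ k a g → Δ^ k (λ x → a * g x) ≐ (λ x → a * Δ^ k g x)
  Δ^-*ˡ zero    a g x = refl
  Δ^-*ˡ (suc k) a g x = trans
    (Δ^-cong k (λ y → solve 3 (λ a b c → a :* b :- a :* c := a :* (b :- c)) refl _ _ _) x)
    (Δ^-*ˡ k a (Δ g) x)

  Δ^-zero : ∀ k → Δ^ k (λ _ → 0#) ≐ (λ _ → 0#)
  Δ^-zero zero    x = refl
  Δ^-zero (suc k) x = trans (Δ^-cong k (λ _ → -‿inverseʳ 0#) x) (Δ^-zero k x)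

  Δ^-sumFin : ∀ k n (G : Fin n → Seq) →
              Δ^ k (λ x → sumFin n (λ i → G i x)) ≐ (λ x → sumFin n (λ i → Δ^ k (G i) x))
  Δ^-sumFin k zero    G x = Δ^-zero k x
  Δ^-sumFin k (suc n) G x = trans (Δ^-+ k _ _ x) (+-congˡ (Δ^-sumFin k n (G ∘ suc) x))

  Δ^-sumTuples : ∀ k f n (G : (Fin f → Fin n) → Seq) →
                 Δ^ k (λ x → sumTuples f n (λ t → G t x)) ≐ (λ x → sumTuples f n (λ t → Δ^ k (G t) x))
  Δ^-sumTuples k zero    n G x = refl
  Δ^-sumTuples k (suc f) n G x = trans (Δ^-sumFin k n _ x)
    (sumFin-cong n (λ i → Δ^-sumTuples k f n (λ t → G (i ∷ t)) x))

  Δ^-Δ : ∀ k g → Δ^ k (Δ g) ≐ Δ (Δ^ k g)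
  Δ^-Δ zero    g x = refl
  Δ^-Δ (suc k) g = Δ^-Δ k (Δ g)

  Δ^-shift : ∀ k g → Δ^ k (g ∘ suc) ≐ Δ^ k g ∘ suc
  Δ^-shift zero    g x = refl
  Δ^-shift (suc k) g = Δ^-shift k (Δ g)

  Δ^-const⇒Δ^suc-zero : ∀ k g d → Δ^ k g ≐ (λ _ → d) → Δ^ (suc k) g ≐ (λ _ → 0#)
  Δ^-const⇒Δ^suc-zero k g d Δ^g≐d x =
    trans (Δ^-Δ k g x) (trans (+-cong (Δ^g≐d (suc x)) (-‿cong (Δ^g≐d x))) (-‿inverseʳ d))

  Δ^-leibniz : ∀ k a b u → Δ^ (suc k) (λ x → (a + ι x * b) * u x) ≐
               (λ x → (a + ι x * b) * Δ^ (suc k) u x + (ι (suc k) * b) * Δ^ k u (suc x))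
  Δ^-leibniz zero a b u x =
    solve 5 (λ a b i u₁ u₀ → (a :+ (con (+ 1) :+ i) :* b) :* u₁ :- (a :+ i :* b) :* u₀
                          := (a :+ i :* b) :* (u₁ :- u₀) :+ ((con (+ 1) :+ con (+ 0)) :* b) :* u₁)
            refl a b (ι x) (u (suc x)) (u x)
  Δ^-leibniz (suc k) a b u x = begin
    Δ^ (suc k) (Δ (λ y → (a + ι y * b) * u y)) x
      ≈⟨ Δ^-cong (suc k) (λ y → solve 5 (λ a b i u₁ u₀ → (a :+ (con (+ 1) :+ i) :* b) :* u₁ :- (a :+ i :* b) :* u₀
                                                      := (a :+ i :* b) :* (u₁ :- u₀) :+ b :* u₁)
                                         refl a b (ι y) (u (suc y)) (u y)) x ⟩
    Δ^ (suc k) (λ y → (a + ι y * b) * Δ u y + b * u (suc y)) x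
      ≈⟨ Δ^-+ (suc k) _ _ x ⟩
    Δ^ (suc k) (λ y → (a + ι y * b) * Δ u y) x + Δ^ (suc k) (λ y → b * u (suc y)) x
      ≈⟨ +-cong (Δ^-leibniz k a b (Δ u) x) (trans (Δ^-*ˡ (suc k) b (u ∘ suc) x) (*-congˡ (Δ^-shift (suc k) u x))) ⟩
    ((a + ι x * b) * Δ^ (suc k) (Δ u) x + (ι (suc k) * b) * Δ^ k (Δ u) (suc x)) + b * Δ^ (suc k) u (suc x)
      ≈⟨ solve 5 (λ p D i b E → (p :* D :+ (i :* b) :* E) :+ b :* E := p :* D :+ ((con (+ 1) :+ i) :* b) :* E) refl _ _ _ _ _ ⟩
    (a + ι x * b) * Δ^ (suc (suc k)) u x + (ι (suc (suc k)) * b) * Δ^ (suc k) u (suc x) ∎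

  affineProd : (r : ℕ) → (Fin r → Carrier) → (Fin r → Carrier) → Seq
  affineProd r a b x = prodFin r (λ k → a k + ι x * b k)

  -- the derivative of y ↦ Π_k y_k at b in the direction a
  ∂prod : (r : ℕ) → (Fin r → Carrier) → (Fin r → Carrier) → Carrier
  ∂prod zero    a b = 0#
  ∂prod (suc r) a b = a zero * prodFin r (b ∘ suc) + b zero * ∂prod r (a ∘ suc) (b ∘ suc)

  ∂prod-cong : ∀ r {a a′ b b′ : Fin r → Carrier} → (∀ k → a k ≈ a′ k) → (∀ k → b k ≈ b′ k) →
               ∂prod r a b ≈ ∂prod r a′ b′
  ∂prod-cong zero    a≈a′ b≈b′ = refl
  ∂prod-cong (suc r) a≈a′ b≈b′ = +-cong (*-cong (a≈a′ zero) (prodFin-cong r (b≈b′ ∘ suc)))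
                                        (*-cong (b≈b′ zero) (∂prod-cong r (a≈a′ ∘ suc) (b≈b′ ∘ suc)))

  Δ^-affineProd : ∀ r a b → Δ^ r (affineProd r a b) ≐ (λ _ → ι (r !) * prodFin r b)
  Δ^-affineProd zero    a b x = sym (trans (*-congʳ (+-identityʳ 1#)) (*-identityˡ 1#))
  Δ^-affineProd (suc r) a b x = begin
    Δ^ (suc r) (λ y → (a zero + ι y * b zero) * P y) x
      ≈⟨ Δ^-leibniz r (a zero) (b zero) P x ⟩
    (a zero + ι x * b zero) * Δ^ (suc r) P x + (ι (suc r) * b zero) * Δ^ r P (suc x)
      ≈⟨ +-cong (*-congˡ (Δ^-const⇒Δ^suc-zero r P _ (Δ^-affineProd r (a ∘ suc) (b ∘ suc)) x))
                (*-congˡ (Δ^-affineProd r (a ∘ suc) (b ∘ suc) (suc x))) ⟩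
    (a zero + ι x * b zero) * 0# + (ι (suc r) * b zero) * (ι (r !) * prodFin r (b ∘ suc))
      ≈⟨ solve 5 (λ p i b j q → p :* con (+ 0) :+ (i :* b) :* (j :* q) := (i :* j) :* (b :* q)) refl _ _ _ _ _ ⟩
    (ι (suc r) * ι (r !)) * prodFin (suc r) b
      ≈⟨ *-congʳ (ι-* (suc r) (r !)) ⟨
    ι (suc r !) * prodFin (suc r) b ∎
    where
    P = affineProd r (a ∘ suc) (b ∘ suc)

  Δ^-affineProd-∂prod : ∀ r a b →
    Δ^ r (λ x → affineProd (suc r) a b x - affineProd (suc r) (λ _ → 0#) b x) ≐ (λ _ → ι (r !) * ∂prod (suc r) a b)
  Δ^-affineProd-∂prod zero a b x =
    solve 3 (λ a i b → (a :+ i :* b) :* con (+ 1) :- (con (+ 0) :+ i :* b) :* con (+ 1)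
                    := (con (+ 1) :+ con (+ 0)) :* (a :* con (+ 1) :+ b :* con (+ 0)))
            refl (a zero) (ι x) (b zero)
  Δ^-affineProd-∂prod (suc r) a b x = begin
    Δ^ (suc r) (λ y → (a zero + ι y * b zero) * U y - (0# + ι y * b zero) * V y) x
      ≈⟨ Δ^-cong (suc r) (λ y → solve 5 (λ a i b u v → (a :+ i :* b) :* u :- (con (+ 0) :+ i :* b) :* v
                                                  := a :* u :+ (con (+ 0) :+ i :* b) :* (u :- v))
                                         refl (a zero) (ι y) (b zero) (U y) (V y)) x ⟩
    Δ^ (suc r) (λ y → a zero * U y + (0# + ι y * b zero) * (U y - V y)) x
      ≈⟨ Δ^-+ (suc r) _ _ x ⟩
    Δ^ (suc r) (λ y → a zero * U y) x + Δ^ (suc r) (λ y → (0# + ι y * b zero) * (U y - V y)) x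
      ≈⟨ +-cong (trans (Δ^-*ˡ (suc r) (a zero) U x) (*-congˡ (Δ^-affineProd (suc r) (a ∘ suc) (b ∘ suc) x)))
                (Δ^-leibniz r 0# (b zero) (λ y → U y - V y) x) ⟩
    a zero * (ι (suc r !) * prodFin (suc r) (b ∘ suc))
      + ((0# + ι x * b zero) * Δ^ (suc r) (λ y → U y - V y) x + (ι (suc r) * b zero) * Δ^ r (λ y → U y - V y) (suc x))
      ≈⟨ +-cong (*-congˡ (*-congʳ (ι-* (suc r) (r !))))
                (+-cong (*-congˡ (Δ^-const⇒Δ^suc-zero r _ _ IH x)) (*-congˡ (IH (suc x)))) ⟩
    a zero * ((ι (suc r) * ι (r !)) * prodFin (suc r) (b ∘ suc))
      + ((0# + ι x * b zero) * 0# + (ι (suc r) * b zero) * (ι (r !) * ∂prod (suc r) (a ∘ suc) (b ∘ suc)))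
      ≈⟨ solve 7 (λ a i j p q b e → a :* ((i :* j) :* p) :+ (q :* con (+ 0) :+ (i :* b) :* (j :* e))
                                 := (i :* j) :* (a :* p :+ b :* e)) refl _ _ _ _ _ _ _ ⟩
    (ι (suc r) * ι (r !)) * ∂prod (suc (suc r)) a b
      ≈⟨ *-congʳ (ι-* (suc r) (r !)) ⟨
    ι (suc r !) * ∂prod (suc (suc r)) a b ∎
    where
    U = affineProd (suc r) (a ∘ suc) (b ∘ suc)
    V = affineProd (suc r) (λ _ → 0#) (b ∘ suc)
    IH = Δ^-affineProd-∂prod r (a ∘ suc) (b ∘ suc)

  size : ∀ {n} → (Fin n → Fin 2) → ℕ
  size {zero}  S = 0
  size {suc n} S = Fin.toℕ (S zero) ℕ.+ size (S ∘ suc)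

  signedSubsetSum≈Δ^ : ∀ n (g : Seq) →
    sumTuples n 2 (λ S → sign n (toBool ∘ S) * g (size S)) ≈ Δ^ n g 0
  signedSubsetSum≈Δ^ zero    g = *-identityˡ _
  signedSubsetSum≈Δ^ (suc n) g = begin
    sumTuples n 2 (λ S → (- 1# * σ S) * g (size S)) + (sumTuples n 2 (λ S → (1# * σ S) * g (suc (size S))) + 0#)
      ≈⟨ +-cong (sumTuples-cong n (λ S → solve 2 (λ s x → (:- con (+ 1) :* s) :* x := :- (s :* x)) refl _ _))
                (trans (+-identityʳ _) (sumTuples-cong n (λ S → *-congʳ (*-identityˡ _)))) ⟩
    sumTuples n 2 (λ S → - (σ S * g (size S))) + sumTuples n 2 (λ S → σ S * g (suc (size S)))
      ≈⟨ sumTuples-distrib-+ n _ _ ⟨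
    sumTuples n 2 (λ S → - (σ S * g (size S)) + σ S * g (suc (size S)))
      ≈⟨ sumTuples-cong n (λ S → solve 3 (λ s a b → :- (s :* b) :+ s :* a := s :* (a :- b)) refl _ _ _) ⟩
    sumTuples n 2 (λ S → σ S * Δ g (size S))
      ≈⟨ signedSubsetSum≈Δ^ n (Δ g) ⟩
    Δ^ (suc n) g 0 ∎
    where
    σ : (Fin n → Fin 2) → Carrier
    σ S = sign n (toBool ∘ S)

  private
    sumVecs-const : ∀ {m} n (S : Fin n → Fin 2) (w : Vect m) i →
                    sumVecs n (toBool ∘ S) (λ _ → w) i ≈ ι (size S) * w i
    sumVecs-const zero    S w i = sym (zeroˡ _)
    sumVecs-const (suc n) S w i with S zero
    ... | zero     = trans (+-congˡ (sumVecs-const n (S ∘ suc) w i)) (+-identityˡ _)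
    ... | suc zero = trans (+-congˡ (sumVecs-const n (S ∘ suc) w i))
                           (solve 2 (λ a b → b :+ a :* b := (con (+ 1) :+ a) :* b) refl _ _)

  assocForm≈Δ^ : ∀ g {n} (c : Carrier) (h : Vect n → Carrier) →
    (∀ {x y} → (∀ i → x i ≈ y i) → h x ≈ h y) → (ξ w : Vect n) →
    assocForm (suc g) c h (ξ ∷ (λ _ → w)) ≈ c * Δ^ g (λ x → h (λ i → ξ i + ι x * w i) - h (λ i → 0# + ι x * w i)) 0
  assocForm≈Δ^ g c h h-cong ξ w = *-congˡ (begin
    sumTuples g 2 (λ S → (- 1# * σ S) * h (zeroV ⊕ V S)) + (sumTuples g 2 (λ S → (1# * σ S) * h (ξ ⊕ V S)) + 0#)
      ≈⟨ +-congˡ (trans (+-identityʳ _) (sumTuples-cong g (λ S → *-congʳ (*-identityˡ _)))) ⟩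
    sumTuples g 2 (λ S → (- 1# * σ S) * h (zeroV ⊕ V S)) + sumTuples g 2 (λ S → σ S * h (ξ ⊕ V S))
      ≈⟨ +-cong (sumTuples-cong g (λ S → trans (*-congˡ (h-cong (λ i → +-congˡ (sumVecs-const g S w i))))
                                               (solve 2 (λ s x → (:- con (+ 1) :* s) :* x := :- (s :* x)) refl _ _)))
                (sumTuples-cong g (λ S → *-congˡ (h-cong (λ i → +-congˡ (sumVecs-const g S w i))))) ⟩
    sumTuples g 2 (λ S → - (σ S * H₀ (size S))) + sumTuples g 2 (λ S → σ S * H₁ (size S))
      ≈⟨ sumTuples-distrib-+ g _ _ ⟨
    sumTuples g 2 (λ S → - (σ S * H₀ (size S)) + σ S * H₁ (size S))
      ≈⟨ sumTuples-cong g (λ S → solve 3 (λ s a b → :- (s :* b) :+ s :* a := s :* (a :- b)) refl _ _ _) ⟩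
    sumTuples g 2 (λ S → σ S * (H₁ (size S) - H₀ (size S)))
      ≈⟨ signedSubsetSum≈Δ^ g (λ x → H₁ x - H₀ x) ⟩
    Δ^ g (λ x → H₁ x - H₀ x) 0 ∎)
    where
    σ : (Fin g → Fin 2) → Carrier
    σ S = sign g (toBool ∘ S)
    V : (Fin g → Fin 2) → Vect _
    V S = sumVecs g (toBool ∘ S) (λ _ → w)
    H₁ H₀ : Seq
    H₁ x = h (λ i → ξ i + ι x * w i)
    H₀ x = h (λ i → 0# + ι x * w i)

  monomialForm : ∀ f n → ((Fin f → Fin n) → Carrier) → Vect n → Carrier
  monomialForm f n c y = sumTuples f n (λ t → c t * prodFin f (y ∘ t))

  monomialForm-cong : ∀ f n c {y y′ : Vect n} → (∀ i → y i ≈ y′ i) → monomialForm f n c y ≈ monomialForm f n c y′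
  monomialForm-cong f n c y≈y′ = sumTuples-cong f (λ t → *-congˡ (prodFin-cong f (y≈y′ ∘ t)))

  Δ^-monomialForm : ∀ g n c (a b : Vect n) →
    Δ^ g (λ x → monomialForm (suc g) n c (λ i → a i + ι x * b i) - monomialForm (suc g) n c (λ i → 0# + ι x * b i)) 0
    ≈ ι (g !) * sumTuples (suc g) n (λ t → c t * ∂prod (suc g) (a ∘ t) (b ∘ t))
  Δ^-monomialForm g n c a b = begin
    Δ^ g (λ x → monomialForm f n c (λ i → a i + ι x * b i) - monomialForm f n c (λ i → 0# + ι x * b i)) 0
      ≈⟨ Δ^-cong g (λ x → sumTuples-distrib-- f (λ t → c t * P₁ t x) (λ t → c t * P₀ t x)) 0 ⟨
    Δ^ g (λ x → sumTuples f n (λ t → c t * P₁ t x - c t * P₀ t x)) 0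
      ≈⟨ Δ^-cong g (λ x → sumTuples-cong {n} f (λ t →
           solve 3 (λ c p q → c :* p :- c :* q := c :* (p :- q)) refl (c t) (P₁ t x) (P₀ t x))) 0 ⟩
    Δ^ g (λ x → sumTuples f n (λ t → c t * (P₁ t x - P₀ t x))) 0
      ≈⟨ Δ^-sumTuples g f n (λ t x → c t * (P₁ t x - P₀ t x)) 0 ⟩
    sumTuples f n (λ t → Δ^ g (λ x → c t * (P₁ t x - P₀ t x)) 0)
      ≈⟨ sumTuples-cong {n} f (λ t → trans (Δ^-*ˡ g (c t) _ 0) (*-congˡ (Δ^-affineProd-∂prod g (a ∘ t) (b ∘ t) 0))) ⟩
    sumTuples f n (λ t → c t * (ι (g !) * ∂prod f (a ∘ t) (b ∘ t)))
      ≈⟨ sumTuples-cong {n} f (λ t →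
           solve 3 (λ c i d → c :* (i :* d) := i :* (c :* d)) refl (c t) (ι (g !)) (∂prod f (a ∘ t) (b ∘ t))) ⟩
    sumTuples f n (λ t → ι (g !) * (c t * ∂prod f (a ∘ t) (b ∘ t)))
      ≈⟨ *-distribˡ-sumTuples f (ι (g !)) (λ t → c t * ∂prod f (a ∘ t) (b ∘ t)) ⟨
    ι (g !) * sumTuples f n (λ t → c t * ∂prod f (a ∘ t) (b ∘ t)) ∎
    where
    f = suc g
    P₁ P₀ : (Fin f → Fin n) → Seq
    P₁ t = affineProd f (a ∘ t) (b ∘ t)
    P₀ t = affineProd f (λ _ → 0#) (b ∘ t)

-- K[ℤ/lℤ], with an element X written as Σ_j X j · T ^ j
module GroupRing {c ℓ} (K : Field c ℓ) (m : ℕ) where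

  open Field K hiding (zero)
  open FieldStuff K using (sumFin; ι)
  open FieldBasics K
  open Residues m
  open CommutativeSemigroupProperties *-commutativeSemigroup using (x∙yz≈y∙xz)
  open SetoidReasoning setoid

  R : Set c
  R = Fin l → Carrier

  open PointwiseEquality setoid public using ()
    renaming (_≋_ to _≐_; ≋-refl to ≐-refl; ≋-sym to ≐-sym; ≋-trans to ≐-trans)

  -- sums over ℤ/lℤ are opaque, so that unification does not unfold them
  -- into l summands
  infix 10 ∑
  syntax ∑ (λ i → e) = ∑[ i ] e

  opaque
    ∑ : R → Carrier
    ∑ = sum

    ∑-cong : ∀ {g h : R} → (∀ i → g i ≈ h i) → ∑ g ≈ ∑ h
    ∑-cong = sum-cong-≋

    ∑-swap : ∀ (g : Fin l → Fin l → Carrier) → ∑[ a ] ∑[ b ] g a b ≈ ∑[ b ] ∑[ a ] g a b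
    ∑-swap = ∑-comm

    *-distribˡ-∑ : ∀ x (g : R) → x * ∑ g ≈ ∑[ i ] (x * g i)
    *-distribˡ-∑ = *-distribˡ-sum

    *-distribʳ-∑ : ∀ x (g : R) → ∑ g * x ≈ ∑[ i ] (g i * x)
    *-distribʳ-∑ = *-distribʳ-sum

    ∑-distrib-+ : ∀ (g h : R) → ∑[ i ] (g i + h i) ≈ ∑ g + ∑ h
    ∑-distrib-+ = sum-distrib-+

    ∑-distrib-- : ∀ (g h : R) → ∑[ i ] (g i - h i) ≈ ∑ g - ∑ h
    ∑-distrib-- = sum-distrib--

    ∑-single : ∀ {g : R} i₀ → (∀ i → i ≢ i₀ → g i ≈ 0#) → ∑ g ≈ g i₀
    ∑-single = sum-single

    sumFin≡∑ : ∀ (g : R) → sumFin l g ≡ ∑ g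
    sumFin≡∑ = sumFin≡sum l

    ∑-sumFin : ∀ n (g : Fin l → Fin n → Carrier) → ∑[ u ] sumFin n (g u) ≈ sumFin n (λ p → ∑[ u ] g u p)
    ∑-sumFin n g = begin
      sum (λ u → sumFin n (g u))      ≡⟨ sum-cong-≗ (λ u → sumFin≡sum n (g u)) ⟩
      sum (λ u → sum (g u))           ≈⟨ ∑-comm g ⟩
      sum (λ p → sum (λ u → g u p))   ≡⟨ sumFin≡sum n _ ⟨
      sumFin n (λ p → sum (λ u → g u p)) ∎

    ∑-const : ∀ x → ∑[ _ ] x ≈ ι l * x
    ∑-const x = trans (reflexive (≡.sym (sumFin≡sum l (λ _ → x)))) (sumFin-const l x)

  [_≋_] : ℕ → ℕ → Carrier
  [ a ≋ b ] = if ⌊ a % l ≟ b % l ⌋ then 1# else 0#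

  [≋]-cong : ∀ {a a′ b b′} → a ≋ a′ → b ≋ b′ → [ a ≋ b ] ≡ [ a′ ≋ b′ ]
  [≋]-cong (mk≋ e) (mk≋ e′) = ≡.cong₂ (λ x y → if ⌊ x ≟ y ⌋ then 1# else 0#) e e′

  [≋]-yes : ∀ {a b} → a ≋ b → [ a ≋ b ] ≡ 1#
  [≋]-yes {a} {b} (mk≋ e) with a % l ≟ b % l
  ... | yes _  = ≡.refl
  ... | no a≢b = ⊥-elim (a≢b e)

  [≋]-no : ∀ {a b} → ¬ a ≋ b → [ a ≋ b ] ≡ 0#
  [≋]-no {a} {b} a≉b with a % l ≟ b % l
  ... | yes e = ⊥-elim (a≉b (mk≋ e))
  ... | no _  = ≡.refl

  [≋]-sym : ∀ a b → [ a ≋ b ] ≡ [ b ≋ a ]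
  [≋]-sym a b with a % l ≟ b % l | b % l ≟ a % l
  ... | yes _ | yes _ = ≡.refl
  ... | no  _ | no  _ = ≡.refl
  ... | yes e | no ne = ⊥-elim (ne (≡.sym e))
  ... | no ne | yes e = ⊥-elim (ne (≡.sym e))

  ∑-[≋]-unique : ∀ (φ : Fin l → ℕ) a (G : R) i₀ → φ i₀ ≋ a → (∀ i → φ i ≋ a → i ≡ i₀) →
                 ∑[ i ] ([ φ i ≋ a ] * G i) ≈ G i₀
  ∑-[≋]-unique φ a G i₀ φi₀≋a unique = begin
    ∑[ i ] ([ φ i ≋ a ] * G i) ≈⟨ ∑-single i₀ (λ i i≢i₀ → trans (*-congʳ (reflexive ([≋]-no (i≢i₀ ∘ unique i)))) (zeroˡ (G i))) ⟩
    [ φ i₀ ≋ a ] * G i₀        ≈⟨ *-congʳ (reflexive ([≋]-yes φi₀≋a)) ⟩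
    1# * G i₀                  ≈⟨ *-identityˡ _ ⟩
    G i₀                       ∎

  ∑-[≋]-mod : ∀ a (G : R) → ∑[ i ] ([ toℕ i ≋ a ] * G i) ≈ G (mod a)
  ∑-[≋]-mod a G = ∑-[≋]-unique toℕ a G (mod a) (mod-≋ a)
    (λ i i≋a → ≡.trans (≡.sym (mod-toℕ i)) (mod-cong i≋a))

  ∑-[≋]-mod′ : ∀ a (G : R) → ∑[ i ] ([ a ≋ toℕ i ] * G i) ≈ G (mod a)
  ∑-[≋]-mod′ a G = trans (∑-cong (λ i → *-congʳ (reflexive ([≋]-sym a (toℕ i))))) (∑-[≋]-mod a G)

  ∑-[+≋] : ∀ a (j : Fin l) (G : R) i₀ → a ℕ.+ toℕ i₀ ≋ toℕ j → ∑[ i ] ([ a ℕ.+ toℕ i ≋ toℕ j ] * G i) ≈ G i₀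
  ∑-[+≋] a j G i₀ e = ∑-[≋]-unique (λ i → a ℕ.+ toℕ i) (toℕ j) G i₀ e
    (λ i e′ → toℕ-≋-injective (≋-cancelˡ-+ a (≋-trans e′ (≋-sym e))))

  ∑-[toℕ≋toℕ] : ∀ (j : Fin l) (G : R) → ∑[ i ] ([ toℕ i ≋ toℕ j ] * G i) ≈ G j
  ∑-[toℕ≋toℕ] j G = ∑-[+≋] 0 j G j ≋-refl

  ∑∑-cong : ∀ {g h : Fin l → Fin l → Carrier} → (∀ a b → g a b ≈ h a b) →
            ∑[ a ] ∑[ b ] g a b ≈ ∑[ a ] ∑[ b ] h a b
  ∑∑-cong g≈h = ∑-cong (λ a → ∑-cong (g≈h a))

  *-distribˡ-∑∑ : ∀ x (g : Fin l → Fin l → Carrier) →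
                  x * (∑[ a ] ∑[ b ] g a b) ≈ ∑[ a ] ∑[ b ] (x * g a b)
  *-distribˡ-∑∑ x g = trans (*-distribˡ-∑ x _) (∑-cong (λ a → *-distribˡ-∑ x (g a)))

  *-distribʳ-∑∑ : ∀ x (g : Fin l → Fin l → Carrier) →
                  (∑[ a ] ∑[ b ] g a b) * x ≈ ∑[ a ] ∑[ b ] (g a b * x)
  *-distribʳ-∑∑ x g = trans (*-distribʳ-∑ x _) (∑-cong (λ a → *-distribʳ-∑ x (g a)))

  infixl 7 _⋆_ _*ₛ_
  infixl 6 _⊞_ _⊟_

  _⋆_ : R → R → R
  (X ⋆ Y) j = ∑[ a ] ∑[ b ] ([ toℕ a ℕ.+ toℕ b ≋ toℕ j ] * (X a * Y b))

  δ : ℕ → R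
  δ k j = [ toℕ j ≋ k ]

  δ₀ : R
  δ₀ = δ 0

  N : R
  N _ = 1#

  _⊞_ _⊟_ : R → R → R
  (X ⊞ Y) j = X j + Y j
  (X ⊟ Y) j = X j - Y j

  _*ₛ_ : Carrier → R → R
  (s *ₛ X) j = s * X j

  ⋆-cong : ∀ {X X′ Y Y′} → X ≐ X′ → Y ≐ Y′ → X ⋆ Y ≐ X′ ⋆ Y′
  ⋆-cong X≐X′ Y≐Y′ j = ∑∑-cong (λ a b → *-congˡ (*-cong (X≐X′ a) (Y≐Y′ b)))

  ⋆-comm : ∀ X Y → X ⋆ Y ≐ Y ⋆ X
  ⋆-comm X Y j = trans (∑-swap (λ a b → [ toℕ a ℕ.+ toℕ b ≋ toℕ j ] * (X a * Y b))) (∑∑-cong (λ b a →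
    *-cong (reflexive ([≋]-cong (≡⇒≋ (ℕₚ.+-comm (toℕ a) (toℕ b))) (≋-refl {toℕ j}))) (*-comm (X a) (Y b))))

  private
    ∑-reorder : ∀ (F : Fin l → Fin l → Fin l → Fin l → Carrier) →
      ∑[ c ] ∑[ r ] ∑[ a ] ∑[ b ] F c r a b ≈ ∑[ a ] ∑[ b ] ∑[ r ] ∑[ c ] F c r a b
    ∑-reorder F = begin
      ∑[ c ] ∑[ r ] ∑[ a ] ∑[ b ] F c r a b
        ≈⟨ ∑-cong (λ c → trans (∑-swap (λ r a → ∑[ b ] F c r a b)) (∑-cong (λ a → ∑-swap (λ r b → F c r a b)))) ⟩
      ∑[ c ] ∑[ a ] ∑[ b ] ∑[ r ] F c r a b
        ≈⟨ trans (∑-swap (λ c a → ∑[ b ] ∑[ r ] F c r a b))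
                 (∑-cong (λ a → trans (∑-swap (λ c b → ∑[ r ] F c r a b))
                                          (∑-cong (λ b → ∑-swap (λ c r → F c r a b))))) ⟩
      ∑[ a ] ∑[ b ] ∑[ r ] ∑[ c ] F c r a b ∎

  ⋆-⋆ : ∀ X Y Z j → ((X ⋆ Y) ⋆ Z) j ≈
        ∑[ a ] ∑[ b ] ∑[ r ] ([ toℕ a ℕ.+ toℕ b ℕ.+ toℕ r ≋ toℕ j ] * (X a * Y b * Z r))
  ⋆-⋆ X Y Z j = begin
    ∑[ c ] ∑[ r ] ([ toℕ c ℕ.+ toℕ r ≋ toℕ j ] * ((X ⋆ Y) c * Z r))
      ≈⟨ ∑∑-cong distribute ⟩
    ∑[ c ] ∑[ r ] ∑[ a ] ∑[ b ] ([ toℕ a ℕ.+ toℕ b ≋ toℕ c ] * F c r a b)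
      ≈⟨ ∑-reorder (λ c r a b → [ toℕ a ℕ.+ toℕ b ≋ toℕ c ] * F c r a b) ⟩
    ∑[ a ] ∑[ b ] ∑[ r ] ∑[ c ] ([ toℕ a ℕ.+ toℕ b ≋ toℕ c ] * F c r a b)
      ≈⟨ ∑-cong (λ a → ∑-cong (λ b → ∑-cong (λ r → collapse a b r))) ⟩
    ∑[ a ] ∑[ b ] ∑[ r ] ([ toℕ a ℕ.+ toℕ b ℕ.+ toℕ r ≋ toℕ j ] * (X a * Y b * Z r)) ∎
    where
    F : Fin l → Fin l → Fin l → Fin l → Carrier
    F c r a b = [ toℕ c ℕ.+ toℕ r ≋ toℕ j ] * (X a * Y b * Z r)
    distribute : ∀ c r → [ toℕ c ℕ.+ toℕ r ≋ toℕ j ] * ((X ⋆ Y) c * Z r) ≈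
                         ∑[ a ] ∑[ b ] ([ toℕ a ℕ.+ toℕ b ≋ toℕ c ] * F c r a b)
    distribute c r = begin
      [ toℕ c ℕ.+ toℕ r ≋ toℕ j ] * ((X ⋆ Y) c * Z r)
        ≈⟨ *-congˡ (*-distribʳ-∑∑ (Z r) G) ⟩
      [ toℕ c ℕ.+ toℕ r ≋ toℕ j ] * (∑[ a ] ∑[ b ] (G a b * Z r))
        ≈⟨ *-distribˡ-∑∑ [ toℕ c ℕ.+ toℕ r ≋ toℕ j ] (λ a b → G a b * Z r) ⟩
      ∑[ a ] ∑[ b ] ([ toℕ c ℕ.+ toℕ r ≋ toℕ j ] * (G a b * Z r))
        ≈⟨ ∑∑-cong (λ a b → solve 4 (λ p q x z → p :* ((q :* x) :* z) := q :* (p :* (x :* z))) refl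
                              [ toℕ c ℕ.+ toℕ r ≋ toℕ j ] [ toℕ a ℕ.+ toℕ b ≋ toℕ c ] (X a * Y b) (Z r)) ⟩
      ∑[ a ] ∑[ b ] ([ toℕ a ℕ.+ toℕ b ≋ toℕ c ] * F c r a b) ∎
      where
      G : Fin l → Fin l → Carrier
      G a b = [ toℕ a ℕ.+ toℕ b ≋ toℕ c ] * (X a * Y b)
    collapse : ∀ a b r → ∑[ c ] ([ toℕ a ℕ.+ toℕ b ≋ toℕ c ] * F c r a b) ≈
                         [ toℕ a ℕ.+ toℕ b ℕ.+ toℕ r ≋ toℕ j ] * (X a * Y b * Z r)
    collapse a b r = begin
      ∑[ c ] ([ toℕ a ℕ.+ toℕ b ≋ toℕ c ] * F c r a b)
        ≈⟨ ∑-cong (λ c → reflexive (≡.cong (_* F c r a b) ([≋]-sym (toℕ a ℕ.+ toℕ b) (toℕ c)))) ⟩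
      ∑[ c ] ([ toℕ c ≋ toℕ a ℕ.+ toℕ b ] * F c r a b)
        ≈⟨ ∑-[≋]-mod (toℕ a ℕ.+ toℕ b) (λ c → F c r a b) ⟩
      F (mod (toℕ a ℕ.+ toℕ b)) r a b
        ≡⟨ ≡.cong (_* (X a * Y b * Z r)) ([≋]-cong (≋-+ (mod-≋ (toℕ a ℕ.+ toℕ b)) (≋-refl {toℕ r})) (≋-refl {toℕ j})) ⟩
      [ toℕ a ℕ.+ toℕ b ℕ.+ toℕ r ≋ toℕ j ] * (X a * Y b * Z r) ∎

  ⋆-assoc : ∀ X Y Z → (X ⋆ Y) ⋆ Z ≐ X ⋆ (Y ⋆ Z)
  ⋆-assoc X Y Z j = begin
    ((X ⋆ Y) ⋆ Z) j
      ≈⟨ ⋆-⋆ X Y Z j ⟩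
    ∑[ a ] ∑[ b ] ∑[ r ] ([ toℕ a ℕ.+ toℕ b ℕ.+ toℕ r ≋ toℕ j ] * (X a * Y b * Z r))
      ≈⟨ ∑-cong (λ a → ∑-cong (λ b → ∑-cong (λ r → *-cong (reflexive ([≋]-cong (rotate a b r) (≋-refl {toℕ j})))
                                                            (solve 3 (λ x y z → x :* y :* z := y :* z :* x) refl (X a) (Y b) (Z r))))) ⟩
    ∑[ a ] ∑[ b ] ∑[ r ] ([ toℕ b ℕ.+ toℕ r ℕ.+ toℕ a ≋ toℕ j ] * (Y b * Z r * X a))
      ≈⟨ ∑-swap (λ a b → ∑[ r ] ([ toℕ b ℕ.+ toℕ r ℕ.+ toℕ a ≋ toℕ j ] * (Y b * Z r * X a))) ⟩
    ∑[ b ] ∑[ a ] ∑[ r ] ([ toℕ b ℕ.+ toℕ r ℕ.+ toℕ a ≋ toℕ j ] * (Y b * Z r * X a))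
      ≈⟨ ∑-cong (λ b → ∑-swap (λ a r → [ toℕ b ℕ.+ toℕ r ℕ.+ toℕ a ≋ toℕ j ] * (Y b * Z r * X a))) ⟩
    ∑[ b ] ∑[ r ] ∑[ a ] ([ toℕ b ℕ.+ toℕ r ℕ.+ toℕ a ≋ toℕ j ] * (Y b * Z r * X a))
      ≈⟨ ⋆-⋆ Y Z X j ⟨
    ((Y ⋆ Z) ⋆ X) j
      ≈⟨ ⋆-comm (Y ⋆ Z) X j ⟩
    (X ⋆ (Y ⋆ Z)) j ∎
    where
    rotate : ∀ a b r → toℕ a ℕ.+ toℕ b ℕ.+ toℕ r ≋ toℕ b ℕ.+ toℕ r ℕ.+ toℕ a
    rotate a b r = ≡⇒≋ (≡.trans (ℕₚ.+-assoc (toℕ a) _ _) (ℕₚ.+-comm (toℕ a) _))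

  δ-⋆ : ∀ k X j b → k ℕ.+ toℕ b ≋ toℕ j → (δ k ⋆ X) j ≈ X b
  δ-⋆ k X j b k+b≋j = begin
    ∑[ a ] ∑[ b ] ([ toℕ a ℕ.+ toℕ b ≋ toℕ j ] * ([ toℕ a ≋ k ] * X b))
      ≈⟨ ∑-swap _ ⟩
    ∑[ b ] ∑[ a ] ([ toℕ a ℕ.+ toℕ b ≋ toℕ j ] * ([ toℕ a ≋ k ] * X b))
      ≈⟨ ∑-cong (λ b → ∑-cong (λ a → x∙yz≈y∙xz _ _ _)) ⟩
    ∑[ b ] ∑[ a ] ([ toℕ a ≋ k ] * ([ toℕ a ℕ.+ toℕ b ≋ toℕ j ] * X b))
      ≈⟨ ∑-cong (λ b → ∑-[≋]-mod k (λ a → [ toℕ a ℕ.+ toℕ b ≋ toℕ j ] * X b)) ⟩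
    ∑[ b ] ([ toℕ (mod k) ℕ.+ toℕ b ≋ toℕ j ] * X b)
      ≈⟨ ∑-cong (λ b → *-congʳ (reflexive ([≋]-cong (≋-+ (mod-≋ k) (≋-refl {toℕ b})) (≋-refl {toℕ j})))) ⟩
    ∑[ b ] ([ k ℕ.+ toℕ b ≋ toℕ j ] * X b)
      ≈⟨ ∑-[+≋] k j X b k+b≋j ⟩
    X b ∎

  δ₀-⋆ : ∀ X → δ₀ ⋆ X ≐ X
  δ₀-⋆ X j = δ-⋆ 0 X j j ≋-refl

  ⋆-δ₀ : ∀ X → X ⋆ δ₀ ≐ X
  ⋆-δ₀ X = ≐-trans (⋆-comm X δ₀) (δ₀-⋆ X)

  ⋆-distribʳ-⊟ : ∀ X X′ Y → (X ⊟ X′) ⋆ Y ≐ X ⋆ Y ⊟ X′ ⋆ Y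
  ⋆-distribʳ-⊟ X X′ Y j = begin
    ∑[ a ] ∑[ b ] ([ toℕ a ℕ.+ toℕ b ≋ toℕ j ] * ((X a - X′ a) * Y b))
      ≈⟨ ∑∑-cong (λ a b → solve 4 (λ p x x′ y → p :* ((x :- x′) :* y) := p :* (x :* y) :- p :* (x′ :* y)) refl _ _ _ _) ⟩
    ∑[ a ] ∑[ b ] ([ toℕ a ℕ.+ toℕ b ≋ toℕ j ] * (X a * Y b) - [ toℕ a ℕ.+ toℕ b ≋ toℕ j ] * (X′ a * Y b))
      ≈⟨ trans (∑-cong (λ a → ∑-distrib-- _ _)) (∑-distrib-- _ _) ⟩
    (X ⋆ Y) j - (X′ ⋆ Y) j ∎

  ⋆-distribˡ-⊞ : ∀ X Y Y′ → X ⋆ (Y ⊞ Y′) ≐ X ⋆ Y ⊞ X ⋆ Y′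
  ⋆-distribˡ-⊞ X Y Y′ j = begin
    ∑[ a ] ∑[ b ] ([ toℕ a ℕ.+ toℕ b ≋ toℕ j ] * (X a * (Y b + Y′ b)))
      ≈⟨ ∑∑-cong (λ a b → solve 4 (λ p x y y′ → p :* (x :* (y :+ y′)) := p :* (x :* y) :+ p :* (x :* y′)) refl _ _ _ _) ⟩
    ∑[ a ] ∑[ b ] ([ toℕ a ℕ.+ toℕ b ≋ toℕ j ] * (X a * Y b) + [ toℕ a ℕ.+ toℕ b ≋ toℕ j ] * (X a * Y′ b))
      ≈⟨ trans (∑-cong (λ a → ∑-distrib-+ _ _)) (∑-distrib-+ _ _) ⟩
    (X ⋆ Y) j + (X ⋆ Y′) j ∎

  ⋆-*ₛ : ∀ s X Y → X ⋆ (s *ₛ Y) ≐ s *ₛ (X ⋆ Y)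
  ⋆-*ₛ s X Y j = begin
    ∑[ a ] ∑[ b ] ([ toℕ a ℕ.+ toℕ b ≋ toℕ j ] * (X a * (s * Y b)))
      ≈⟨ ∑∑-cong (λ a b → solve 4 (λ p x s y → p :* (x :* (s :* y)) := s :* (p :* (x :* y))) refl _ _ _ _) ⟩
    ∑[ a ] ∑[ b ] (s * ([ toℕ a ℕ.+ toℕ b ≋ toℕ j ] * (X a * Y b)))
      ≈⟨ *-distribˡ-∑∑ s _ ⟨
    s * (X ⋆ Y) j ∎

  *ₛ-⋆ : ∀ s X Y → (s *ₛ X) ⋆ Y ≐ s *ₛ (X ⋆ Y)
  *ₛ-⋆ s X Y j = trans (⋆-comm (s *ₛ X) Y j) (trans (⋆-*ₛ s Y X j) (*-congˡ (⋆-comm Y X j)))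

  ⋆-zeroˡ : ∀ {Z} Y → (∀ j → Z j ≈ 0#) → ∀ j → (Z ⋆ Y) j ≈ 0#
  ⋆-zeroˡ {Z} Y Z≈0 j = begin
    (Z ⋆ Y) j           ≈⟨ ⋆-cong (λ i → trans (Z≈0 i) (sym (zeroˡ (Z i)))) ≐-refl j ⟩
    ((0# *ₛ Z) ⋆ Y) j   ≈⟨ *ₛ-⋆ 0# Z Y j ⟩
    0# * (Z ⋆ Y) j      ≈⟨ zeroˡ _ ⟩
    0#                  ∎

  ⋆-N : ∀ X j → (X ⋆ N) j ≈ ∑ X
  ⋆-N X j = ∑-cong λ a → begin
    ∑[ b ] ([ toℕ a ℕ.+ toℕ b ≋ toℕ j ] * (X a * 1#))
      ≈⟨ ∑-cong (λ b → solve 2 (λ p x → p :* (x :* con (+ 1)) := x :* (p :* con (+ 1))) refl _ _) ⟩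
    ∑[ b ] (X a * ([ toℕ a ℕ.+ toℕ b ≋ toℕ j ] * 1#))
      ≈⟨ *-distribˡ-∑ (X a) _ ⟨
    X a * ∑[ b ] ([ toℕ a ℕ.+ toℕ b ≋ toℕ j ] * 1#)
      ≈⟨ *-congˡ (∑-[+≋] (toℕ a) j (λ _ → 1#) _ (proj₂ (∃-+-≋ (toℕ a) j))) ⟩
    X a * 1#
      ≈⟨ *-identityʳ _ ⟩
    X a ∎

  ∑-⋆ : ∀ X Y → ∑ (X ⋆ Y) ≈ ∑ X * ∑ Y
  ∑-⋆ X Y = begin
    ∑[ j ] ∑[ a ] ∑[ b ] ([ toℕ a ℕ.+ toℕ b ≋ toℕ j ] * (X a * Y b))
      ≈⟨ trans (∑-swap _) (∑-cong (λ a → ∑-swap _)) ⟩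
    ∑[ a ] ∑[ b ] ∑[ j ] ([ toℕ a ℕ.+ toℕ b ≋ toℕ j ] * (X a * Y b))
      ≈⟨ ∑∑-cong (λ a b → trans (∑-cong (λ j → *-congʳ (reflexive ([≋]-sym (toℕ a ℕ.+ toℕ b) (toℕ j)))))
                                (∑-[≋]-mod (toℕ a ℕ.+ toℕ b) (λ _ → X a * Y b))) ⟩
    ∑[ a ] ∑[ b ] (X a * Y b)
      ≈⟨ trans (*-distribʳ-∑ _ X) (∑-cong (λ a → *-distribˡ-∑ (X a) Y)) ⟨
    ∑ X * ∑ Y ∎

  τ : ℕ → R → R
  τ u X j = ∑[ i ] ([ u ℕ.* toℕ i ≋ toℕ j ] * X i)

  τ-≋ : ∀ {u u′} X → u ≋ u′ → τ u X ≐ τ u′ X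
  τ-≋ X u≋u′ j = ∑-cong (λ i → *-congʳ (reflexive ([≋]-cong (≋-* u≋u′ (≋-refl {toℕ i})) (≋-refl {toℕ j}))))

  τ-1 : ∀ X → τ 1 X ≐ X
  τ-1 X j = trans (∑-cong (λ i → *-congʳ (reflexive ([≋]-cong (≡⇒≋ (ℕₚ.*-identityˡ (toℕ i))) (≋-refl {toℕ j})))))
                  (∑-[toℕ≋toℕ] j X)

  τ-∘ : ∀ v u X → τ v (τ u X) ≐ τ (v ℕ.* u) X
  τ-∘ v u X j = begin
    ∑[ i ] ([ v ℕ.* toℕ i ≋ toℕ j ] * ∑[ a ] ([ u ℕ.* toℕ a ≋ toℕ i ] * X a))
      ≈⟨ ∑-cong (λ i → trans (*-distribˡ-∑ _ _) (∑-cong (λ a → x∙yz≈y∙xz _ _ _))) ⟩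
    ∑[ i ] ∑[ a ] ([ u ℕ.* toℕ a ≋ toℕ i ] * ([ v ℕ.* toℕ i ≋ toℕ j ] * X a))
      ≈⟨ ∑-swap _ ⟩
    ∑[ a ] ∑[ i ] ([ u ℕ.* toℕ a ≋ toℕ i ] * ([ v ℕ.* toℕ i ≋ toℕ j ] * X a))
      ≈⟨ ∑-cong (λ a → ∑-[≋]-mod′ (u ℕ.* toℕ a) (λ i → [ v ℕ.* toℕ i ≋ toℕ j ] * X a)) ⟩
    ∑[ a ] ([ v ℕ.* toℕ (mod (u ℕ.* toℕ a)) ≋ toℕ j ] * X a)
      ≈⟨ ∑-cong (λ a → *-congʳ (reflexive ([≋]-cong (≋-trans (≋-* (≋-refl {v}) (mod-≋ (u ℕ.* toℕ a)))
                                                                (≡⇒≋ (≡.sym (ℕₚ.*-assoc v u (toℕ a)))))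
                                                       (≋-refl {toℕ j})))) ⟩
    ∑[ a ] ([ v ℕ.* u ℕ.* toℕ a ≋ toℕ j ] * X a) ∎

  τ-δ₀ : ∀ u → τ u δ₀ ≐ δ₀
  τ-δ₀ u j = begin
    ∑[ i ] ([ u ℕ.* toℕ i ≋ toℕ j ] * [ toℕ i ≋ 0 ])
      ≈⟨ ∑-cong (λ i → *-comm _ _) ⟩
    ∑[ i ] ([ toℕ i ≋ 0 ] * [ u ℕ.* toℕ i ≋ toℕ j ])
      ≈⟨ ∑-[≋]-mod 0 (λ i → [ u ℕ.* toℕ i ≋ toℕ j ]) ⟩
    [ u ℕ.* toℕ (mod 0) ≋ toℕ j ]
      ≡⟨ [≋]-cong (≋-trans (≋-* (≋-refl {u}) (mod-≋ 0)) (≡⇒≋ (ℕₚ.*-zeroʳ u))) (≋-refl {toℕ j}) ⟩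
    [ 0 ≋ toℕ j ]
      ≡⟨ [≋]-sym 0 (toℕ j) ⟩
    δ₀ j ∎

  ∑-τ : ∀ u X → ∑ (τ u X) ≈ ∑ X
  ∑-τ u X = trans (∑-swap _) (∑-cong (λ i → ∑-[≋]-mod′ (u ℕ.* toℕ i) (λ _ → X i)))

  private
    τ-⋆-apply : ∀ u X Y j → τ u (X ⋆ Y) j ≈ ∑[ a ] ∑[ b ] ([ u ℕ.* (toℕ a ℕ.+ toℕ b) ≋ toℕ j ] * (X a * Y b))
    τ-⋆-apply u X Y j = begin
      ∑[ i ] ([ u ℕ.* toℕ i ≋ toℕ j ] * (X ⋆ Y) i)
        ≈⟨ ∑-cong (λ i → trans (*-distribˡ-∑∑ _ _) (∑∑-cong (λ a b → x∙yz≈y∙xz _ _ _))) ⟩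
      ∑[ i ] ∑[ a ] ∑[ b ] ([ toℕ a ℕ.+ toℕ b ≋ toℕ i ] * ([ u ℕ.* toℕ i ≋ toℕ j ] * (X a * Y b)))
        ≈⟨ trans (∑-swap _) (∑-cong (λ a → ∑-swap _)) ⟩
      ∑[ a ] ∑[ b ] ∑[ i ] ([ toℕ a ℕ.+ toℕ b ≋ toℕ i ] * ([ u ℕ.* toℕ i ≋ toℕ j ] * (X a * Y b)))
        ≈⟨ ∑∑-cong (λ a b → trans (∑-[≋]-mod′ (toℕ a ℕ.+ toℕ b) (λ i → [ u ℕ.* toℕ i ≋ toℕ j ] * (X a * Y b)))
             (*-congʳ (reflexive ([≋]-cong (≋-* (≋-refl {u}) (mod-≋ (toℕ a ℕ.+ toℕ b))) (≋-refl {toℕ j}))))) ⟩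
      ∑[ a ] ∑[ b ] ([ u ℕ.* (toℕ a ℕ.+ toℕ b) ≋ toℕ j ] * (X a * Y b)) ∎

    τ⋆τ-apply : ∀ u X Y j → (τ u X ⋆ τ u Y) j ≈ ∑[ a ] ∑[ b ] ([ u ℕ.* (toℕ a ℕ.+ toℕ b) ≋ toℕ j ] * (X a * Y b))
    τ⋆τ-apply u X Y j = begin
      ∑[ c ] ∑[ d ] ([ toℕ c ℕ.+ toℕ d ≋ toℕ j ] * (τ u X c * τ u Y d))
        ≈⟨ ∑∑-cong (λ c d → distribute c d) ⟩
      ∑[ c ] ∑[ d ] ∑[ a ] ∑[ b ] F c d a b
        ≈⟨ ∑-reorder F ⟩
      ∑[ a ] ∑[ b ] ∑[ d ] ∑[ c ] F c d a b
        ≈⟨ ∑∑-cong (λ a b → ∑-cong (λ d → ∑-[≋]-mod′ (u ℕ.* toℕ a)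
             (λ c → [ u ℕ.* toℕ b ≋ toℕ d ] * ([ toℕ c ℕ.+ toℕ d ≋ toℕ j ] * (X a * Y b))))) ⟩
      ∑[ a ] ∑[ b ] ∑[ d ] ([ u ℕ.* toℕ b ≋ toℕ d ] * ([ toℕ (mod (u ℕ.* toℕ a)) ℕ.+ toℕ d ≋ toℕ j ] * (X a * Y b)))
        ≈⟨ ∑∑-cong (λ a b → ∑-[≋]-mod′ (u ℕ.* toℕ b)
             (λ d → [ toℕ (mod (u ℕ.* toℕ a)) ℕ.+ toℕ d ≋ toℕ j ] * (X a * Y b))) ⟩
      ∑[ a ] ∑[ b ] ([ toℕ (mod (u ℕ.* toℕ a)) ℕ.+ toℕ (mod (u ℕ.* toℕ b)) ≋ toℕ j ] * (X a * Y b))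
        ≈⟨ ∑∑-cong (λ a b → *-congʳ (reflexive ([≋]-cong (≋-trans (≋-+ (mod-≋ (u ℕ.* toℕ a)) (mod-≋ (u ℕ.* toℕ b)))
                                                                   (≡⇒≋ (≡.sym (ℕₚ.*-distribˡ-+ u (toℕ a) (toℕ b)))))
                                                          (≋-refl {toℕ j})))) ⟩
      ∑[ a ] ∑[ b ] ([ u ℕ.* (toℕ a ℕ.+ toℕ b) ≋ toℕ j ] * (X a * Y b)) ∎
      where
      F : Fin l → Fin l → Fin l → Fin l → Carrier
      F c d a b = [ u ℕ.* toℕ a ≋ toℕ c ] * ([ u ℕ.* toℕ b ≋ toℕ d ] * ([ toℕ c ℕ.+ toℕ d ≋ toℕ j ] * (X a * Y b)))
      distribute : ∀ c d → [ toℕ c ℕ.+ toℕ d ≋ toℕ j ] * (τ u X c * τ u Y d) ≈ ∑[ a ] ∑[ b ] F c d a b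
      distribute c d = begin
        [ toℕ c ℕ.+ toℕ d ≋ toℕ j ] * (τ u X c * τ u Y d)
          ≈⟨ *-congˡ (trans (*-distribʳ-∑ _ _) (∑-cong (λ a → *-distribˡ-∑ _ _))) ⟩
        [ toℕ c ℕ.+ toℕ d ≋ toℕ j ] * ∑[ a ] ∑[ b ] (([ u ℕ.* toℕ a ≋ toℕ c ] * X a) * ([ u ℕ.* toℕ b ≋ toℕ d ] * Y b))
          ≈⟨ *-distribˡ-∑∑ _ _ ⟩
        ∑[ a ] ∑[ b ] ([ toℕ c ℕ.+ toℕ d ≋ toℕ j ] * (([ u ℕ.* toℕ a ≋ toℕ c ] * X a) * ([ u ℕ.* toℕ b ≋ toℕ d ] * Y b)))
          ≈⟨ ∑∑-cong (λ a b → solve 5 (λ p q r x y → p :* ((q :* x) :* (r :* y)) := q :* (r :* (p :* (x :* y)))) refl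
                                [ toℕ c ℕ.+ toℕ d ≋ toℕ j ] [ u ℕ.* toℕ a ≋ toℕ c ] [ u ℕ.* toℕ b ≋ toℕ d ] (X a) (Y b)) ⟩
        ∑[ a ] ∑[ b ] F c d a b ∎

  τ-⋆ : ∀ u X Y → τ u (X ⋆ Y) ≐ τ u X ⋆ τ u Y
  τ-⋆ u X Y j = trans (τ-⋆-apply u X Y j) (sym (τ⋆τ-apply u X Y j))

  ∏⋆ : ℕ → (ℕ → R) → R
  ∏⋆ zero    g = δ₀
  ∏⋆ (suc d) g = g 0 ⋆ ∏⋆ d (g ∘ suc)

  ∏⋆-cong : ∀ d {g h : ℕ → R} → (∀ k → g k ≐ h k) → ∏⋆ d g ≐ ∏⋆ d h
  ∏⋆-cong zero    g≐h = ≐-refl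
  ∏⋆-cong (suc d) g≐h = ⋆-cong (g≐h 0) (∏⋆-cong d (g≐h ∘ suc))

  τ-∏⋆ : ∀ u d g → τ u (∏⋆ d g) ≐ ∏⋆ d (λ k → τ u (g k))
  τ-∏⋆ u zero    g = τ-δ₀ u
  τ-∏⋆ u (suc d) g = ≐-trans (τ-⋆ u _ _) (⋆-cong ≐-refl (τ-∏⋆ u d (g ∘ suc)))

  ∏⋆-suc : ∀ d g → ∏⋆ (suc d) g ≐ ∏⋆ d g ⋆ g d
  ∏⋆-suc zero    g = ≐-trans (⋆-δ₀ (g 0)) (≐-sym (δ₀-⋆ (g 0)))
  ∏⋆-suc (suc d) g = ≐-trans (⋆-cong ≐-refl (∏⋆-suc d (g ∘ suc))) (≐-sym (⋆-assoc _ _ _))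

  ∏⋆-rotate : ∀ d g → g d ≐ g 0 → ∏⋆ d (g ∘ suc) ≐ ∏⋆ d g
  ∏⋆-rotate zero    g _       = ≐-refl
  ∏⋆-rotate (suc d) g gd≐g0 =
    ≐-trans (∏⋆-suc d (g ∘ suc)) (≐-trans (⋆-cong ≐-refl gd≐g0) (⋆-comm _ _))

  ⋆-apply : ∀ X Y j → (X ⋆ Y) j ≈ ∑[ b ] (X (proj₁ (∃-+-≋ (toℕ b) j)) * Y b)
  ⋆-apply X Y j = trans (∑-swap _) (∑-cong λ b → begin
    ∑[ a ] ([ toℕ a ℕ.+ toℕ b ≋ toℕ j ] * (X a * Y b))
      ≈⟨ ∑-cong (λ a → *-congʳ (reflexive ([≋]-cong (≡⇒≋ (ℕₚ.+-comm (toℕ a) (toℕ b))) (≋-refl {toℕ j})))) ⟩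
    ∑[ a ] ([ toℕ b ℕ.+ toℕ a ≋ toℕ j ] * (X a * Y b))
      ≈⟨ ∑-[+≋] (toℕ b) j (λ a → X a * Y b) _ (proj₂ (∃-+-≋ (toℕ b) j)) ⟩
    X (proj₁ (∃-+-≋ (toℕ b) j)) * Y b ∎)

  module _ (l-prime : Prime l) where

    τ-zero : ∀ {u} → Unit l-prime u → ∀ X → τ u X zero ≈ X zero
    τ-zero {u} u-unit X = ∑-[≋]-unique (λ i → u ℕ.* toℕ i) 0 X zero (≡⇒≋ (ℕₚ.*-zeroʳ u))
      (λ i ui≋0 → toℕ-≋-injective (≋-cancelˡ-* l-prime u-unit (≋-trans ui≋0 (≡⇒≋ (≡.sym (ℕₚ.*-zeroʳ u))))))

private
  extend : ∀ {p} (P : ℕ → Set p) {j k} → (j < k → P j) → P k → j ≤ k → P j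
  extend P P<k Pk j≤k = [ P<k , (λ { ≡.refl → Pk }) ]′ (ℕₚ.m≤n⇒m<n∨m≡n j≤k)

¬¬-lastFailure : ∀ {p} (P : ℕ → Set p) k → ¬ (∀ j → j < k → P j) →
                 ¬ ¬ (∃[ n ] (n < k × ¬ P n × (∀ j → n < j → j < k → P j)))
¬¬-lastFailure P zero    ¬all = λ _ → ¬all (λ _ ())
¬¬-lastFailure P (suc k) ¬all found = ¬¬-excluded-middle λ where
  (no ¬Pk) → found (k , ℕₚ.≤-refl , ¬Pk , λ j k<j j<1+k → contradiction (ℕₚ.≤-pred j<1+k) (ℕₚ.<⇒≱ k<j))
  (yes Pk) → ¬¬-lastFailure P k (λ all → ¬all (λ j j<1+k → extend P (all j) Pk (ℕₚ.≤-pred j<1+k)))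
    λ (n , n<k , ¬Pn , above) → found (n , ℕₚ.m<n⇒m<1+n n<k , ¬Pn ,
      λ j n<j j<1+k → extend P (above j n<j) Pk (ℕₚ.≤-pred j<1+k))

module Domain {c ℓ} (K : Field c ℓ) (m : ℕ) where

  open Field K hiding (zero)
  open FieldStuff K using (Irreducible; cyclotomic; Poly; DegLe; _·_; sumFin)
  open FieldBasics K
  open Residues m
  open GroupRing K m
  open SetoidReasoning setoid

  Constant : R → Set ℓ
  Constant Z = ∀ j → Z j ≈ Z zero

  ⋆-Constant : ∀ W {V} → Constant V → Constant (W ⋆ V)
  ⋆-Constant W {V} V-const j = begin
    (W ⋆ V) j                ≈⟨ ⋆-cong ≐-refl V≐V₀N j ⟩
    (W ⋆ (V zero *ₛ N)) j    ≈⟨ ⋆-*ₛ (V zero) W N j ⟩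
    V zero * (W ⋆ N) j       ≈⟨ *-congˡ (trans (⋆-N W j) (sym (⋆-N W zero))) ⟩
    V zero * (W ⋆ N) zero    ≈⟨ ⋆-*ₛ (V zero) W N zero ⟨
    (W ⋆ (V zero *ₛ N)) zero ≈⟨ ⋆-cong ≐-refl V≐V₀N zero ⟨
    (W ⋆ V) zero             ∎
    where
    V≐V₀N : V ≐ V zero *ₛ N
    V≐V₀N i = trans (V-const i) (sym (*-identityʳ _))

  δ₀-nonConstant : 0 < m → ¬ Constant δ₀
  δ₀-nonConstant 0<m constant = 1≉0 (begin
    1#                           ≡⟨ [≋]-yes (≋-refl {0}) ⟨
    δ₀ zero                      ≈⟨ constant (suc (fromℕ< 0<m)) ⟨
    δ₀ (suc (fromℕ< 0<m))        ≡⟨ [≋]-no (Fin.0≢1+n ∘ ≡.sym ∘ toℕ-≋-injective) ⟩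
    0#                           ∎)

  module Annihilator (Y : R) where

    Ann : R → Set ℓ
    Ann Z = Constant (Z ⋆ Y)

    Ann-cong : ∀ {Z Z′} → Z ≐ Z′ → Ann Z → Ann Z′
    Ann-cong Z≐Z′ Z∈ j = trans (sym (⋆-cong Z≐Z′ ≐-refl j)) (trans (Z∈ j) (⋆-cong Z≐Z′ ≐-refl zero))

    Ann-⊟ : ∀ {Z Z′} → Ann Z → Ann Z′ → Ann (Z ⊟ Z′)
    Ann-⊟ Z∈ Z′∈ j = trans (⋆-distribʳ-⊟ _ _ Y j) (trans (+-cong (Z∈ j) (-‿cong (Z′∈ j))) (sym (⋆-distribʳ-⊟ _ _ Y zero)))

    Ann-*ₛ : ∀ s {Z} → Ann Z → Ann (s *ₛ Z)
    Ann-*ₛ s Z∈ j = trans (*ₛ-⋆ s _ Y j) (trans (*-congˡ (Z∈ j)) (sym (*ₛ-⋆ s _ Y zero)))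

    Ann-⋆ : ∀ W {Z} → Ann Z → Ann (W ⋆ Z)
    Ann-⋆ W {Z} Z∈ j = trans (⋆-assoc W Z Y j) (trans (⋆-Constant W Z∈ j) (sym (⋆-assoc W Z Y zero)))

    Ann-N : Ann N
    Ann-N j = trans (⋆-comm N Y j) (trans (⋆-N Y j) (sym (trans (⋆-comm N Y zero) (⋆-N Y zero))))

    Ann-δ₀ : Ann δ₀ → Constant Y
    Ann-δ₀ δ₀∈ j = trans (sym (δ₀-⋆ Y j)) (trans (δ₀∈ j) (δ₀-⋆ Y zero))

  Monic : R → ℕ → Set ℓ
  Monic G n = G (mod n) ≈ 1# × (∀ j → n < toℕ j → G j ≈ 0#)

  ¬¬-lastNonzero : ∀ (Z : R) → ¬ (∀ j → Z j ≈ 0#) →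
                   ¬ ¬ (∃[ n ] (n < l × ¬ Z (mod n) ≈ 0# × (∀ j → n < toℕ j → Z j ≈ 0#)))
  ¬¬-lastNonzero Z Z≉0 found = ¬¬-lastFailure P l
      (λ all → Z≉0 (λ j → vanish j (all (toℕ j) (Fin.toℕ<n j))))
      (λ (n , n<l , Zn≉0 , above) → found (n , n<l , Zn≉0 , λ j n<j → vanish j (above (toℕ j) n<j (Fin.toℕ<n j))))
    where
    P : ℕ → Set ℓ
    P n = Z (mod n) ≈ 0#
    vanish : ∀ j → P (toℕ j) → Z j ≈ 0#
    vanish j = ≡.subst (λ i → Z i ≈ 0#) (mod-toℕ j)

  normalize : ∀ (Z : R) n → ¬ Z (mod n) ≈ 0# → (∀ j → n < toℕ j → Z j ≈ 0#) → ∃[ s ] Monic (s *ₛ Z) n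
  normalize Z n Zn≉0 above = let s , Zn*s≈1 = inverse (Z (mod n)) Zn≉0 in
    s , trans (*-comm s _) Zn*s≈1 , λ j n<j → trans (*-congˡ (above j n<j)) (zeroʳ s)

  -- long division of N by a monic G of degree n
  module Division (G : R) (n : ℕ) (n≤m : n ≤ m) (G-monic : Monic G n) where

    r : ℕ
    r = m ∸ n

    Partial : ℕ → Set (c ⊔ ℓ)
    Partial s = ∃[ Q ] ((∀ i → r < toℕ i → Q i ≈ 0#) × (∀ j → l ∸ s ≤ toℕ j → (Q ⋆ G) j ≈ 1#))

    -- subtracting a multiple of T ^ (r - s) fixes the coefficient of T ^ (m - s)
    partial-step : ∀ s → s ≤ r → Partial s → Partial (suc s)
    partial-step s s≤r previous = Q′ , Q′-support , Q′⋆G-top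
      where
      Q = proj₁ previous
      k = r ∸ s
      n+k≡m∸s : n ℕ.+ k ≡ m ∸ s
      n+k≡m∸s = ≡.trans (≡.sym (ℕₚ.m+n∸n≡m (n ℕ.+ k) s)) (≡.cong (_∸ s) (≡.trans (ℕₚ.+-assoc n k s)
                  (≡.trans (≡.cong (n ℕ.+_) (ℕₚ.m∸n+n≡m s≤r)) (ℕₚ.m+[n∸m]≡n n≤m))))
      k<l : k < l
      k<l = s≤s (ℕₚ.≤-trans (ℕₚ.m∸n≤m r s) (ℕₚ.m∸n≤m m n))
      d = (Q ⋆ G) (mod (n ℕ.+ k)) - 1#
      Q′ = Q ⊟ d *ₛ δ k

      Q′-support : ∀ i → r < toℕ i → Q′ i ≈ 0#
      Q′-support i r<i = begin
        Q i - d * [ toℕ i ≋ k ] ≈⟨ +-cong (proj₁ (proj₂ previous) i r<i) (-‿cong (*-congˡ (reflexive ([≋]-no i≉k)))) ⟩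
        0# - d * 0#             ≈⟨ solve 1 (λ d → con (+ 0) :- d :* con (+ 0) := con (+ 0)) refl d ⟩
        0#                      ∎
        where
        i≉k : ¬ toℕ i ≋ k
        i≉k i≋k = ℕₚ.<⇒≢ (ℕₚ.≤-<-trans (ℕₚ.m∸n≤m r s) r<i) (≡.sym (<l-≋-injective (Fin.toℕ<n i) k<l i≋k))

      Q′⋆G-top : ∀ j → l ∸ suc s ≤ toℕ j → (Q′ ⋆ G) j ≈ 1#
      Q′⋆G-top j m∸s≤j = begin
        (Q′ ⋆ G) j                   ≈⟨ ⋆-distribʳ-⊟ Q (d *ₛ δ k) G j ⟩
        (Q ⋆ G) j - (d *ₛ δ k ⋆ G) j ≈⟨ +-congˡ (-‿cong (trans (*ₛ-⋆ d (δ k) G j) (*-congˡ (δ-⋆ k G j b k+b≋j)))) ⟩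
        (Q ⋆ G) j - d * G b          ≈⟨ top (ℕₚ.m≤n⇒m<n∨m≡n m∸s≤j) ⟩
        1#                           ∎
        where
        k≤j : k ≤ toℕ j
        k≤j = ℕₚ.≤-trans (ℕₚ.m≤n+m k n) (≡.subst (_≤ toℕ j) (≡.sym n+k≡m∸s) m∸s≤j)
        b = mod (toℕ j ∸ k)
        toℕ-b : toℕ b ≡ toℕ j ∸ k
        toℕ-b = mod-< (ℕₚ.≤-<-trans (ℕₚ.m∸n≤m (toℕ j) k) (Fin.toℕ<n j))
        k+b≋j : k ℕ.+ toℕ b ≋ toℕ j
        k+b≋j = ≡⇒≋ (≡.trans (≡.cong (k ℕ.+_) toℕ-b) (ℕₚ.m+[n∸m]≡n k≤j))
        top : m ∸ s < toℕ j ⊎ m ∸ s ≡ toℕ j → (Q ⋆ G) j - d * G b ≈ 1#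
        top (inj₁ m∸s<j) = begin
          (Q ⋆ G) j - d * G b ≈⟨ +-cong (proj₂ (proj₂ previous) j l∸s≤j) (-‿cong (*-congˡ (proj₂ G-monic b n<b))) ⟩
          1# - d * 0#         ≈⟨ solve 2 (λ o d → o :- d :* con (+ 0) := o) refl 1# d ⟩
          1#                  ∎
          where
          l∸s≤j : l ∸ s ≤ toℕ j
          l∸s≤j = ≡.subst (_≤ toℕ j) (≡.sym (ℕₚ.+-∸-assoc 1 (ℕₚ.≤-trans s≤r (ℕₚ.m∸n≤m m n)))) m∸s<j
          n<b : n < toℕ b
          n<b = ≡.subst (n <_) (≡.sym toℕ-b) (ℕₚ.m+n≤o⇒m≤o∸n (suc n) (≡.subst (_< toℕ j) (≡.sym n+k≡m∸s) m∸s<j))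
        top (inj₂ m∸s≡j) = begin
          (Q ⋆ G) j - d * G b                    ≈⟨ +-congˡ (-‿cong (*-cong (reflexive (≡.cong (λ i → (Q ⋆ G) i - 1#) j≡)) Gb≈1)) ⟩
          (Q ⋆ G) j - ((Q ⋆ G) j - 1#) * 1#      ≈⟨ solve 1 (λ x → x :- (x :- con (+ 1)) :* con (+ 1) := con (+ 1)) refl _ ⟩
          1#                                     ∎
          where
          j≡n+k : toℕ j ≡ n ℕ.+ k
          j≡n+k = ≡.trans (≡.sym m∸s≡j) (≡.sym n+k≡m∸s)
          j≡ : mod (n ℕ.+ k) ≡ j
          j≡ = ≡.trans (≡.cong mod (≡.sym j≡n+k)) (mod-toℕ j)
          Gb≈1 : G b ≈ 1#
          Gb≈1 = trans (reflexive (≡.cong (G ∘ mod) (≡.trans (≡.cong (_∸ k) j≡n+k) (ℕₚ.m+n∸n≡m n k)))) (proj₁ G-monic)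

    partial : ∀ s → s ≤ suc r → Partial s
    partial zero    _     = (λ _ → 0#) , (λ _ _ → refl) , (λ j l≤j → contradiction (Fin.toℕ<n j) (ℕₚ.≤⇒≯ l≤j))
    partial (suc s) s<1+r = partial-step s (ℕₚ.≤-pred s<1+r) (partial s (ℕₚ.m≤n⇒m≤1+n (ℕₚ.≤-pred s<1+r)))

    division : ∃[ Q ] ((∀ i → r < toℕ i → Q i ≈ 0#) × (∀ j → n ≤ toℕ j → (Q ⋆ G) j ≈ 1#))
    division = let Q , Q-support , Q⋆G-top = partial (suc r) ℕₚ.≤-refl in
      Q , Q-support , λ j n≤j → Q⋆G-top j (≡.subst (_≤ toℕ j) (≡.sym (ℕₚ.m∸[m∸n]≡n n≤m)) n≤j)

  toPoly : R → Poly
  toPoly Z k = if ⌊ k <? l ⌋ then Z (mod k) else 0#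

  toPoly-< : ∀ Z {k} → k < l → toPoly Z k ≡ Z (mod k)
  toPoly-< Z {k} k<l with k <? l
  ... | yes _   = ≡.refl
  ... | no  k≮l = contradiction k<l k≮l

  toPoly-≮ : ∀ Z {k} → ¬ k < l → toPoly Z k ≡ 0#
  toPoly-≮ Z {k} k≮l with k <? l
  ... | yes k<l = contradiction k<l k≮l
  ... | no  _   = ≡.refl

  toPoly-cong : ∀ {Z Z′} → Z ≐ Z′ → ∀ k → toPoly Z k ≈ toPoly Z′ k
  toPoly-cong Z≐Z′ k with k <? l
  ... | yes _ = Z≐Z′ (mod k)
  ... | no  _ = refl

  toPoly-degree : ∀ Z t → (∀ j → t < toℕ j → Z j ≈ 0#) → DegLe (toPoly Z) t
  toPoly-degree Z t Z-vanish k t<k with k <? l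
  ... | yes k<l = Z-vanish (mod k) (≡.subst (t <_) (≡.sym (mod-< k<l)) t<k)
  ... | no  _   = refl

  -- when the degrees add up to at most m, multiplication in K[ℤ/lℤ] does not wrap around
  module _ (G Q : R) (n r : ℕ) (n+r≡m : n ℕ.+ r ≡ m)
           (G-degree : ∀ j → n < toℕ j → G j ≈ 0#) (Q-degree : ∀ j → r < toℕ j → Q j ≈ 0#) where

    private
      G-vanish : ∀ x → n < x → toPoly G x ≈ 0#
      G-vanish = toPoly-degree G n G-degree
      Q-vanish : ∀ x → r < x → toPoly Q x ≈ 0#
      Q-vanish = toPoly-degree Q r Q-degree

    toPoly-·-≮ : ∀ k → ¬ k < l → (toPoly G · toPoly Q) k ≈ 0#
    toPoly-·-≮ k k≮l = sumFin-zero (suc k) term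
      where
      term : ∀ (i : Fin (suc k)) → toPoly G (toℕ i) * toPoly Q (k ∸ toℕ i) ≈ 0#
      term i with toℕ i ≤? n
      ... | no  i≰n = trans (*-congʳ (G-vanish (toℕ i) (ℕₚ.≰⇒> i≰n))) (zeroˡ _)
      ... | yes i≤n = trans (*-congˡ (Q-vanish (k ∸ toℕ i) r<k∸i)) (zeroʳ _)
        where
        r<k∸i : r < k ∸ toℕ i
        r<k∸i = ℕₚ.m+n≤o⇒m≤o∸n (suc r) (ℕₚ.≤-trans (ℕₚ.+-monoʳ-≤ (suc r) i≤n)
                  (≡.subst (_≤ k) (≡.sym (≡.cong suc (≡.trans (ℕₚ.+-comm r n) n+r≡m))) (ℕₚ.≮⇒≥ k≮l)))

    toPoly-·-< : ∀ k → k < l → (toPoly G · toPoly Q) k ≈ (Q ⋆ G) (mod k)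
    toPoly-·-< k k<l = begin
      sumFin (suc k) (H ∘ toℕ)
        ≈⟨ sumFin-truncate l k H k<l ⟨
      sumFin l (λ b → if ⌊ toℕ b ≤? k ⌋ then H (toℕ b) else 0#)
        ≡⟨ sumFin≡∑ _ ⟩
      ∑[ b ] (if ⌊ toℕ b ≤? k ⌋ then H (toℕ b) else 0#)
        ≈⟨ ∑-cong term ⟩
      ∑[ b ] (Q (a₀ b) * G b)
        ≈⟨ ⋆-apply Q G (mod k) ⟨
      (Q ⋆ G) (mod k) ∎
      where
      H : ℕ → Carrier
      H x = toPoly G x * toPoly Q (k ∸ x)
      a₀ : Fin l → Fin l
      a₀ b = proj₁ (∃-+-≋ (toℕ b) (mod k))
      b+a₀≋k : ∀ b → toℕ b ℕ.+ toℕ (a₀ b) ≋ k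
      b+a₀≋k b = ≋-trans (proj₂ (∃-+-≋ (toℕ b) (mod k))) (mod-≋ k)
      term : ∀ b → (if ⌊ toℕ b ≤? k ⌋ then H (toℕ b) else 0#) ≈ Q (a₀ b) * G b
      term b with toℕ b ≤? k
      ... | yes b≤k = begin
        toPoly G (toℕ b) * toPoly Q (k ∸ toℕ b) ≡⟨ ≡.cong₂ _*_ (≡.trans (toPoly-< G (Fin.toℕ<n b)) (≡.cong G (mod-toℕ b)))
                                                                (toPoly-< Q (ℕₚ.≤-<-trans (ℕₚ.m∸n≤m k (toℕ b)) k<l)) ⟩
        G b * Q (mod (k ∸ toℕ b))               ≈⟨ *-comm _ _ ⟩
        Q (mod (k ∸ toℕ b)) * G b               ≡⟨ ≡.cong (λ a → Q a * G b) a₀≡ ⟨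
        Q (a₀ b) * G b                          ∎
        where
        a₀≡ : a₀ b ≡ mod (k ∸ toℕ b)
        a₀≡ = ≡.trans (≡.sym (mod-toℕ (a₀ b))) (mod-cong (≋-cancelˡ-+ (toℕ b)
                (≋-trans (b+a₀≋k b) (≡⇒≋ (≡.sym (ℕₚ.m+[n∸m]≡n b≤k))))))
      ... | no b≰k with toℕ b ≤? n | toℕ (a₀ b) ≤? r
      ...   | no  b≰n | _        = sym (trans (*-congˡ (G-degree b (ℕₚ.≰⇒> b≰n))) (zeroʳ _))
      ...   | yes _   | no  a₀≰r = sym (trans (*-congʳ (Q-degree (a₀ b) (ℕₚ.≰⇒> a₀≰r))) (zeroˡ _))
      ...   | yes b≤n | yes a₀≤r = contradiction (≡.subst (toℕ b ≤_) b+a₀≡k (ℕₚ.m≤m+n (toℕ b) (toℕ (a₀ b)))) b≰k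
        where
        b+a₀≡k : toℕ b ℕ.+ toℕ (a₀ b) ≡ k
        b+a₀≡k = <l-≋-injective (s≤s (≡.subst (toℕ b ℕ.+ toℕ (a₀ b) ≤_) n+r≡m (ℕₚ.+-mono-≤ b≤n a₀≤r))) k<l (b+a₀≋k b)

    toPoly-⋆ : ∀ k → (toPoly G · toPoly Q) k ≈ toPoly (Q ⋆ G) k
    toPoly-⋆ k = by-cases (k <? l)
      where
      by-cases : Dec (k < l) → (toPoly G · toPoly Q) k ≈ toPoly (Q ⋆ G) k
      by-cases (yes k<l) = trans (toPoly-·-< k k<l) (sym (reflexive (toPoly-< (Q ⋆ G) k<l)))
      by-cases (no  k≮l) = trans (toPoly-·-≮ k k≮l) (sym (reflexive (toPoly-≮ (Q ⋆ G) k≮l)))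

  module _ (irreducible : Irreducible (cyclotomic l) m) where

    module NoMonic (Y : R) (Y-nonConstant : ¬ Constant Y) where

      open Annihilator Y

      NoMonicBelow : ℕ → Set (c ⊔ ℓ)
      NoMonicBelow d = ∀ G n → n < d → Ann G → ¬ Monic G n

      ¬¬-vanish : ∀ {d} → NoMonicBelow d → ∀ {Z} → Ann Z → (∀ j → d ≤ toℕ j → Z j ≈ 0#) → ¬ ¬ (∀ j → Z j ≈ 0#)
      ¬¬-vanish {d} none {Z} Z∈ Z-high Z≉0 = ¬¬-lastNonzero Z Z≉0 λ (n , n<l , Zn≉0 , above) →
        by-cases (n <? d) n<l Zn≉0 above
        where
        by-cases : ∀ {n} → Dec (n < d) → n < l → ¬ Z (mod n) ≈ 0# → (∀ j → n < toℕ j → Z j ≈ 0#) → ⊥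
        by-cases {n} (yes n<d) _ Zn≉0 above =
          let s , sZ-monic = normalize Z n Zn≉0 above in none (s *ₛ Z) n n<d (Ann-*ₛ s Z∈) sZ-monic
        by-cases {n} (no n≮d) n<l Zn≉0 _ =
          Zn≉0 (Z-high (mod n) (≡.subst (d ≤_) (≡.sym (mod-< n<l)) (ℕₚ.≮⇒≥ n≮d)))

      -- a monic G of degree n in the ideal would divide N, hence Φ_l
      noMonic : ∀ G n → n < m → NoMonicBelow n → Ann G → ¬ Monic G n
      noMonic G zero    _   _    G∈ G-monic = Y-nonConstant (Ann-δ₀ (Ann-cong G≐δ₀ G∈))
        where
        G≐δ₀ : G ≐ δ₀
        G≐δ₀ zero    = trans (proj₁ G-monic) (sym (reflexive ([≋]-yes (≋-refl {0}))))
        G≐δ₀ (suc j) = trans (proj₂ G-monic (suc j) (s≤s z≤n))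
          (sym (reflexive ([≋]-no {toℕ (suc j)} {0} (Fin.0≢1+n ∘ ≡.sym ∘ toℕ-≋-injective {suc j} {zero}))))
      noMonic G n@(suc _) n<m none G∈ G-monic = ¬¬-vanish none Rem∈ Rem-high λ Rem≐0 →
        irreducible (toPoly G , toPoly Q , n , r , s≤s z≤n , ℕₚ.m<n⇒0<n∸m n<m , n+r≡m ,
                     toPoly-degree G n (proj₂ G-monic) , toPoly-degree Q r Q-degree ,
                     λ k → trans (toPoly-⋆ G Q n r n+r≡m (proj₂ G-monic) Q-degree k)
                                 (toPoly-cong (λ j → x-y≈0⇒x≈y _ _ (Rem≐0 j)) k))
        where
        open Division G n (ℕₚ.<⇒≤ n<m) G-monic using (r; division)
        n+r≡m = ℕₚ.m+[n∸m]≡n (ℕₚ.<⇒≤ n<m)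
        Q = proj₁ division
        Q-degree = proj₁ (proj₂ division)
        Rem = Q ⋆ G ⊟ N
        Rem∈ : Ann Rem
        Rem∈ = Ann-⊟ (Ann-⋆ Q G∈) Ann-N
        Rem-high : ∀ j → n ≤ toℕ j → Rem j ≈ 0#
        Rem-high j n≤j = trans (+-congʳ (proj₂ (proj₂ division) j n≤j)) (-‿inverseʳ 1#)

      noMonicBelow : ∀ d → d ≤ m → NoMonicBelow d
      noMonicBelow zero    _   G n ()
      noMonicBelow (suc d) d<m G n n<1+d with ℕₚ.m≤n⇒m<n∨m≡n (ℕₚ.≤-pred n<1+d)
      ... | inj₁ n<d    = noMonicBelow d (ℕₚ.<⇒≤ d<m) G n n<d
      ... | inj₂ ≡.refl = noMonic G n d<m (noMonicBelow d (ℕₚ.<⇒≤ d<m))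

      ¬¬-Ann-vanish : ∀ {Z} → Ann Z → (∀ j → m ≤ toℕ j → Z j ≈ 0#) → ¬ ¬ (∀ j → Z j ≈ 0#)
      ¬¬-Ann-vanish = ¬¬-vanish (noMonicBelow m ℕₚ.≤-refl)

    -- K[ℤ/lℤ] / (N) ≅ K[x] / (Φ_l) is a field
    ⋆-nonConstant : ∀ {X Y} → ¬ Constant X → ¬ Constant Y → ¬ Constant (X ⋆ Y)
    ⋆-nonConstant {X} {Y} X-nonConstant Y-nonConstant XY-constant =
      ¬¬-Ann-vanish X′∈ X′-high λ X′≐0 → X-nonConstant λ j → trans (X≈Xm X′≐0 j) (sym (X≈Xm X′≐0 zero))
      where
      open Annihilator Y
      open NoMonic Y Y-nonConstant using (¬¬-Ann-vanish)
      X′ : R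
      X′ = X ⊟ X (mod m) *ₛ N
      X′∈ : Ann X′
      X′∈ = Ann-⊟ XY-constant (Ann-*ₛ (X (mod m)) Ann-N)
      X′-high : ∀ j → m ≤ toℕ j → X′ j ≈ 0#
      X′-high j m≤j = trans (+-congˡ (-‿cong (trans (*-identityʳ _) (reflexive (≡.cong X j≡m)))))
                            (-‿inverseʳ (X j))
        where
        j≡m : mod m ≡ j
        j≡m = ≡.trans (≡.cong mod (ℕₚ.≤-antisym m≤j (ℕₚ.≤-pred (Fin.toℕ<n j)))) (mod-toℕ j)
      X≈Xm : (∀ j → X′ j ≈ 0#) → ∀ j → X j ≈ X (mod m)
      X≈Xm X′≐0 j = trans (x-y≈0⇒x≈y _ _ (X′≐0 j)) (*-identityʳ _)

    ∏⋆-nonConstant : 0 < m → ∀ d h → (∀ k → ¬ Constant (h k)) → ¬ Constant (∏⋆ d h)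
    ∏⋆-nonConstant 0<m zero    h _             = δ₀-nonConstant 0<m
    ∏⋆-nonConstant 0<m (suc d) h h-nonConstant =
      ⋆-nonConstant (h-nonConstant 0) (∏⋆-nonConstant 0<m d (h ∘ suc) (h-nonConstant ∘ suc))

module UnitVectorSums {c ℓ} (K : Field c ℓ) (m : ℕ) where

  open Field K hiding (zero)
  open FieldStuff K
  open FieldBasics K
  open FiniteDifferences K using (∂prod)
  open Residues m
  open GroupRing K m
  open SetoidReasoning setoid

  Extensional : ∀ {n} → ((Fin n → Fin l) → Carrier) → Set ℓ
  Extensional c = ∀ t t′ → (∀ k → t k ≡ t′ k) → c t ≈ c t′

  sumTuples-prod-δ : ∀ n J (G : (Fin n → Fin l) → Carrier) → Extensional G →
                     sumTuples n l (λ t → G t * prodFin n (δ (toℕ J) ∘ t)) ≈ G (λ _ → J)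
  sumTuples-prod-δ zero    J G G-ext = trans (*-identityʳ _) (G-ext _ _ (λ ()))
  sumTuples-prod-δ (suc n) J G G-ext = begin
    sumFin l (λ u → sumTuples n l (λ t → G (u ∷ t) * (δ (toℕ J) u * prodFin n (δ (toℕ J) ∘ t))))
      ≡⟨ sumFin≡∑ _ ⟩
    ∑[ u ] sumTuples n l (λ t → G (u ∷ t) * (δ (toℕ J) u * prodFin n (δ (toℕ J) ∘ t)))
      ≈⟨ ∑-cong (λ u → trans (sumTuples-cong n (λ t → x∙yz≈y∙xz _ _ _)) (sym (*-distribˡ-sumTuples n _ _))) ⟩
    ∑[ u ] (δ (toℕ J) u * sumTuples n l (λ t → G (u ∷ t) * prodFin n (δ (toℕ J) ∘ t)))
      ≈⟨ ∑-cong (λ u → *-congˡ (sumTuples-prod-δ n J (G ∘ (u ∷_))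
           (λ t t′ t≗t′ → G-ext _ _ λ { zero → ≡.refl ; (suc k) → t≗t′ k }))) ⟩
    ∑[ u ] ([ toℕ u ≋ toℕ J ] * G (u ∷ (λ _ → J)))
      ≈⟨ ∑-[toℕ≋toℕ] J (λ u → G (u ∷ (λ _ → J))) ⟩
    G (J ∷ (λ _ → J))
      ≈⟨ G-ext _ _ (λ { zero → ≡.refl ; (suc k) → ≡.refl }) ⟩
    G (λ _ → J) ∎
    where open CommutativeSemigroupProperties *-commutativeSemigroup using (x∙yz≈y∙xz)

  sumTuples-∂prod-δ : ∀ n J (c : (Fin n → Fin l) → Carrier) (a : R) → Extensional c →
    sumTuples n l (λ t → c t * ∂prod n (a ∘ t) (δ (toℕ J) ∘ t)) ≈
    sumFin n (λ p → ∑[ u ] (c (updateAt (λ _ → J) p (λ _ → u)) * a u))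
  sumTuples-∂prod-δ zero    J c a c-ext = zeroʳ _
  sumTuples-∂prod-δ (suc n) J c a c-ext = begin
    sumFin l (λ u → sumTuples n l (λ t → c (u ∷ t) * (a u * Π t + δ (toℕ J) u * ∂ t)))
      ≡⟨ sumFin≡∑ _ ⟩
    ∑[ u ] sumTuples n l (λ t → c (u ∷ t) * (a u * Π t + δ (toℕ J) u * ∂ t))
      ≈⟨ ∑-cong (λ u → trans (sumTuples-cong n (λ t → distribˡ _ _ _)) (sumTuples-distrib-+ n _ _)) ⟩
    ∑[ u ] (sumTuples n l (λ t → c (u ∷ t) * (a u * Π t)) + sumTuples n l (λ t → c (u ∷ t) * (δ (toℕ J) u * ∂ t)))
      ≈⟨ ∑-distrib-+ _ _ ⟩
    ∑[ u ] sumTuples n l (λ t → c (u ∷ t) * (a u * Π t))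
      + ∑[ u ] sumTuples n l (λ t → c (u ∷ t) * (δ (toℕ J) u * ∂ t))
      ≈⟨ +-cong (∑-cong first) rest ⟩
    ∑[ u ] (c (updateAt (λ _ → J) zero (λ _ → u)) * a u)
      + sumFin n (λ p → ∑[ u ] (c (updateAt (λ _ → J) (suc p) (λ _ → u)) * a u)) ∎
    where
    open CommutativeSemigroupProperties *-commutativeSemigroup using (x∙yz≈y∙xz)
    Π ∂ : (Fin n → Fin l) → Carrier
    Π t = prodFin n (δ (toℕ J) ∘ t)
    ∂ t = ∂prod n (a ∘ t) (δ (toℕ J) ∘ t)
    first : ∀ u → sumTuples n l (λ t → c (u ∷ t) * (a u * Π t)) ≈ c (updateAt (λ _ → J) zero (λ _ → u)) * a u
    first u = begin
      sumTuples n l (λ t → c (u ∷ t) * (a u * Π t))  ≈⟨ sumTuples-cong n (λ t → sym (*-assoc _ _ _)) ⟩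
      sumTuples n l (λ t → c (u ∷ t) * a u * Π t)    ≈⟨ sumTuples-prod-δ n J (λ t → c (u ∷ t) * a u)
                                                          (λ t t′ t≗t′ → *-congʳ (c-ext _ _ λ { zero → ≡.refl ; (suc k) → t≗t′ k })) ⟩
      c (u ∷ (λ _ → J)) * a u                        ≈⟨ *-congʳ (c-ext _ _ λ { zero → ≡.refl ; (suc k) → ≡.refl }) ⟩
      c (updateAt (λ _ → J) zero (λ _ → u)) * a u    ∎
    rest : ∑[ u ] sumTuples n l (λ t → c (u ∷ t) * (δ (toℕ J) u * ∂ t)) ≈
           sumFin n (λ p → ∑[ u ] (c (updateAt (λ _ → J) (suc p) (λ _ → u)) * a u))
    rest = begin
      ∑[ u ] sumTuples n l (λ t → c (u ∷ t) * (δ (toℕ J) u * ∂ t))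
        ≈⟨ ∑-cong (λ u → trans (sumTuples-cong n (λ t → x∙yz≈y∙xz _ _ _)) (sym (*-distribˡ-sumTuples n _ _))) ⟩
      ∑[ u ] ([ toℕ u ≋ toℕ J ] * sumTuples n l (λ t → c (u ∷ t) * ∂ t))
        ≈⟨ ∑-[toℕ≋toℕ] J (λ u → sumTuples n l (λ t → c (u ∷ t) * ∂ t)) ⟩
      sumTuples n l (λ t → c (J ∷ t) * ∂ t)
        ≈⟨ sumTuples-∂prod-δ n J (c ∘ (J ∷_)) (a) (λ t t′ t≗t′ → c-ext _ _ λ { zero → ≡.refl ; (suc k) → t≗t′ k }) ⟩
      sumFin n (λ p → ∑[ u ] (c (J ∷ updateAt (λ _ → J) p (λ _ → u)) * a u))
        ≈⟨ sumFin-cong n (λ p → ∑-cong (λ u → *-congʳ (c-ext _ _ λ { zero → ≡.refl ; (suc k) → ≡.refl }))) ⟩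
      sumFin n (λ p → ∑[ u ] (c (updateAt (λ _ → J) (suc p) (λ _ → u)) * a u)) ∎

module Weights {c ℓ} (K : Field c ℓ) (m : ℕ) (m≥2 : 2 ≤ m) (l-prime : Prime (suc m))
               (γ : ℕ) (generator : IsGeneratorMod (suc m) γ)
               (e g : ℕ) (m≡e*f : m ≡ e ℕ.* suc g) (f≥2 : 2 ≤ suc g) where

  open FieldStuff K using (weight)
  open Residues m
  open Generator m m≥2 l-prime γ generator
  open GeometricSum e (suc g) m≡e*f f≥2
  open ≋-Reasoning

  weight-ext : ∀ n (t t′ : Fin n → Fin l) → (∀ k → t k ≡ t′ k) → weight n l β t ≡ weight n l β t′
  weight-ext zero    t t′ t≗t′ = ≡.refl
  weight-ext (suc n) t t′ t≗t′ =
    ≡.cong₂ (λ a w → toℕ a ℕ.+ β ℕ.* w) (t≗t′ zero) (weight-ext n (t ∘ suc) (t′ ∘ suc) (t≗t′ ∘ suc))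

  weight-const : ∀ n (J : Fin l) → weight n l β (λ _ → J) ≡ toℕ J ℕ.* geom n
  weight-const zero    J = ≡.sym (ℕₚ.*-zeroʳ (toℕ J))
  weight-const (suc n) J = ≡.trans (≡.cong (λ w → toℕ J ℕ.+ β ℕ.* w) (weight-const n J)) (lemma (toℕ J) β (geom n))
    where
    lemma : ∀ j b s → j ℕ.+ b ℕ.* (j ℕ.* s) ≡ j ℕ.* (1 ℕ.+ b ℕ.* s)
    lemma = solve-∀

  weight-updateAt : ∀ n J p (u : Fin l) →
    weight n l β (updateAt (λ _ → J) p (λ _ → u)) ≡ toℕ J ℕ.* geomExcept n p ℕ.+ β ℕ.^ toℕ p ℕ.* toℕ u
  weight-updateAt (suc n) J zero    u = ≡.trans (≡.cong (λ w → toℕ u ℕ.+ β ℕ.* w) (weight-const n J))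
    (lemma (toℕ u) β (toℕ J) (geom n))
    where
    lemma : ∀ u b j s → u ℕ.+ b ℕ.* (j ℕ.* s) ≡ j ℕ.* (b ℕ.* s) ℕ.+ 1 ℕ.* u
    lemma = solve-∀
  weight-updateAt (suc n) J (suc p) u = ≡.trans (≡.cong (λ w → toℕ J ℕ.+ β ℕ.* w) (weight-updateAt n J p u))
    (lemma (toℕ J) β (geomExcept n p) (β ℕ.^ toℕ p) (toℕ u))
    where
    lemma : ∀ j b s q u → j ℕ.+ b ℕ.* (j ℕ.* s ℕ.+ q ℕ.* u) ≡ j ℕ.* (1 ℕ.+ b ℕ.* s) ℕ.+ b ℕ.* q ℕ.* u
    lemma = solve-∀

  weight-updateAt-≋ : ∀ (J : Fin l) p (u v : Fin l) → toℕ u ℕ.+ toℕ v ≋ toℕ J →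
                      weight (suc g) l β (updateAt (λ _ → J) p (λ _ → u)) ≋ toℕ v ℕ.* geomExcept (suc g) p
  weight-updateAt-≋ J p u v u+v≋J = begin
    weight (suc g) l β (updateAt (λ _ → J) p (λ _ → u))  ≡⟨ weight-updateAt (suc g) J p u ⟩
    toℕ J ℕ.* s ℕ.+ q ℕ.* toℕ u                          ≈⟨ ≋-+ (≋-* (≋-sym u+v≋J) (≋-refl {s})) (≋-refl {q ℕ.* toℕ u}) ⟩
    (toℕ u ℕ.+ toℕ v) ℕ.* s ℕ.+ q ℕ.* toℕ u              ≡⟨ lemma (toℕ u) (toℕ v) s q ⟩
    toℕ u ℕ.* (s ℕ.+ q) ℕ.+ toℕ v ℕ.* s                  ≡⟨ ≡.cong (λ x → toℕ u ℕ.* x ℕ.+ toℕ v ℕ.* s) (geomExcept+β^p (suc g) p) ⟩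
    toℕ u ℕ.* geom (suc g) ℕ.+ toℕ v ℕ.* s               ≈⟨ ≋-+ (≋-* (≋-refl {toℕ u}) geom-≋0) (≋-refl {toℕ v ℕ.* s}) ⟩
    toℕ u ℕ.* 0 ℕ.+ toℕ v ℕ.* s                          ≡⟨ ≡.cong (ℕ._+ toℕ v ℕ.* s) (ℕₚ.*-zeroʳ (toℕ u)) ⟩
    toℕ v ℕ.* s                                          ∎
    where
    s = geomExcept (suc g) p
    q = β ℕ.^ toℕ p
    lemma : ∀ u v s q → (u ℕ.+ v) ℕ.* s ℕ.+ q ℕ.* u ≡ u ℕ.* (s ℕ.+ q) ℕ.+ v ℕ.* s
    lemma = solve-∀

module Regularity {c ℓ} (K : Field c ℓ) (m : ℕ) (m≥2 : 2 ≤ m) (l-prime : Prime (suc m))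
               (γ : ℕ) (generator : IsGeneratorMod (suc m) γ)
               (e g : ℕ) (m≡e*f : m ≡ e ℕ.* suc g) (f≥2 : 2 ≤ suc g) where

  open Field K hiding (zero)
  open FieldStuff K
  open FieldBasics K
  open FiniteDifferences K
    using (Δ^; Δ^-cong; ∂prod; ∂prod-cong; assocForm≈Δ^; monomialForm; monomialForm-cong; Δ^-monomialForm)
  open Residues m
  open Generator m m≥2 l-prime γ generator
  open GeometricSum e (suc g) m≡e*f f≥2
  open Weights K m m≥2 l-prime γ generator e g m≡e*f f≥2
  open GroupRing K m
  open Domain K m
  open UnitVectorSums K m
  open SetoidReasoning setoid

  f : ℕ
  f = suc g

  -- the coefficient of a monomial of weight w in h
  χ : ℕ → Carrier
  χ w = [ w ≋ 0 ] - [ w ≋ γ ]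

  coefficient : (Fin f → Fin l) → Carrier
  coefficient t = χ (weight f l β t)

  coefficient-ext : Extensional coefficient
  coefficient-ext t t′ t≗t′ = reflexive (≡.cong χ (weight-ext f t t′ t≗t′))

  formH≈monomialForm : ∀ x → formH f m β γ x ≈ monomialForm f l coefficient (coord x)
  formH≈monomialForm x = begin
    sumTuples f l (λ t → if C₀ t then Π t else 0#) - sumTuples f l (λ t → if Cγ t then Π t else 0#)
      ≈⟨ sumTuples-distrib-- {l} f (λ t → if C₀ t then Π t else 0#) (λ t → if Cγ t then Π t else 0#) ⟨
    sumTuples f l (λ t → (if C₀ t then Π t else 0#) - (if Cγ t then Π t else 0#))
      ≈⟨ sumTuples-cong {l} f (λ t → trans (+-cong (guard (C₀ t) (Π t)) (-‿cong (guard (Cγ t) (Π t))))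
                                        (sym ([y-z]x≈yx-zx (Π t) _ _))) ⟩
    monomialForm f l coefficient (coord x) ∎
    where
    C₀ Cγ : (Fin f → Fin l) → Bool
    C₀ t = ⌊ weight f l β t ℕ.% l ℕ.≟ 0 ⌋
    Cγ t = ⌊ weight f l β t ℕ.% l ℕ.≟ γ ℕ.% l ⌋
    Π : (Fin f → Fin l) → Carrier
    Π t = prodFin f (coord x ∘ t)
    guard : ∀ b y → (if b then y else 0#) ≈ (if b then 1# else 0#) * y
    guard true  y = sym (*-identityˡ y)
    guard false y = sym (zeroˡ y)

  formH-cong : ∀ {x y : Vect m} → (∀ i → x i ≈ y i) → formH f m β γ x ≈ formH f m β γ y
  formH-cong {x} {y} x≈y = begin
    formH f m β γ x                         ≈⟨ formH≈monomialForm x ⟩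
    monomialForm f l coefficient (coord x)  ≈⟨ monomialForm-cong f l coefficient coord-x≈y ⟩
    monomialForm f l coefficient (coord y)  ≈⟨ formH≈monomialForm y ⟨
    formH f m β γ y                         ∎
    where
    coord-x≈y : ∀ u → coord x u ≈ coord y u
    coord-x≈y zero    = refl
    coord-x≈y (suc i) = x≈y i

  P : R
  P v = sumFin f (λ p → χ (toℕ v ℕ.* geomExcept f p))

  -- e_J, the J-th unit vector of K ^ m (J ≥ 1 in the paper's indexing)
  unitVector : Fin m → Vect m
  unitVector J = δ (toℕ (suc J)) ∘ suc

  coord-unitVector : ∀ J u → coord (unitVector J) u ≈ δ (toℕ (suc J)) u
  coord-unitVector J zero    = sym (reflexive ([≋]-no {0} {suc (toℕ J)} (Fin.0≢1+n ∘ toℕ-≋-injective {zero} {suc J})))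
  coord-unitVector J (suc i) = refl

  θ-diagonal-∂prod : ∀ c (ξ w : Vect m) →
    assocForm f c (formH f m β γ) (ξ ∷ (λ _ → w)) ≈
    c * (ι (g !) * sumTuples f l (λ t → coefficient t * ∂prod f (coord ξ ∘ t) (coord w ∘ t)))
  θ-diagonal-∂prod c ξ w = begin
    assocForm f c (formH f m β γ) (ξ ∷ (λ _ → w))
      ≈⟨ assocForm≈Δ^ g c (formH f m β γ) formH-cong ξ w ⟩
    c * Δ^ g (λ x → formH f m β γ (λ i → ξ i + ι x * w i) - formH f m β γ (λ i → 0# + ι x * w i)) 0
      ≈⟨ *-congˡ (Δ^-cong g (λ x → +-cong (trans (formH≈monomialForm _) (monomialForm-cong f l coefficient (line x)))
                                         (-‿cong (trans (formH≈monomialForm _) (monomialForm-cong f l coefficient (line₀ x))))) 0) ⟩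
    c * Δ^ g (λ x → monomialForm f l coefficient (λ u → coord ξ u + ι x * coord w u)
                  - monomialForm f l coefficient (λ u → 0# + ι x * coord w u)) 0
      ≈⟨ *-congˡ (Δ^-monomialForm g l coefficient (coord ξ) (coord w)) ⟩
    c * (ι (g !) * sumTuples f l (λ t → coefficient t * ∂prod f (coord ξ ∘ t) (coord w ∘ t))) ∎
    where
    line : ∀ x u → coord (λ i → ξ i + ι x * w i) u ≈ coord ξ u + ι x * coord w u
    line x zero    = sym (trans (+-identityˡ _) (zeroʳ _))
    line x (suc i) = refl
    line₀ : ∀ x u → coord (λ i → 0# + ι x * w i) u ≈ 0# + ι x * coord w u
    line₀ x zero    = sym (trans (+-identityˡ _) (zeroʳ _))
    line₀ x (suc i) = refl

  coefficient-∂prod-δ≈⋆P : ∀ (a : R) J → sumTuples f l (λ t → coefficient t * ∂prod f (a ∘ t) (δ (toℕ J) ∘ t)) ≈ (a ⋆ P) J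
  coefficient-∂prod-δ≈⋆P a J = begin
    sumTuples f l (λ t → coefficient t * ∂prod f (a ∘ t) (δ (toℕ J) ∘ t))
      ≈⟨ sumTuples-∂prod-δ f J coefficient a coefficient-ext ⟩
    sumFin f (λ p → ∑[ u ] (coefficient (updateAt (λ _ → J) p (λ _ → u)) * a u))
      ≈⟨ ∑-sumFin f (λ u p → coefficient (updateAt (λ _ → J) p (λ _ → u)) * a u) ⟨
    ∑[ u ] sumFin f (λ p → coefficient (updateAt (λ _ → J) p (λ _ → u)) * a u)
      ≈⟨ ∑-cong (λ u → trans (sym (*-distribʳ-sumFin f (a u) (λ p → coefficient (updateAt (λ _ → J) p (λ _ → u)))))
                             (*-congʳ (sumFin-cong f (χ-weight u)))) ⟩
    ∑[ u ] (P (a₀ u) * a u)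
      ≈⟨ trans (⋆-comm a P J) (⋆-apply P a J) ⟨
    (a ⋆ P) J ∎
    where
    a₀ : Fin l → Fin l
    a₀ u = proj₁ (∃-+-≋ (toℕ u) J)
    χ-weight : ∀ u p → coefficient (updateAt (λ _ → J) p (λ _ → u)) ≈ χ (toℕ (a₀ u) ℕ.* geomExcept f p)
    χ-weight u p = reflexive (≡.cong₂ _-_
      ([≋]-cong (weight-updateAt-≋ J p u (a₀ u) (proj₂ (∃-+-≋ (toℕ u) J))) (≋-refl {0}))
      ([≋]-cong (weight-updateAt-≋ J p u (a₀ u) (proj₂ (∃-+-≋ (toℕ u) J))) (≋-refl {γ})))

  θ-diagonal : ∀ c (ξ : Vect m) J →
    assocForm f c (formH f m β γ) (ξ ∷ (λ _ → unitVector J)) ≈ c * (ι (g !) * (coord ξ ⋆ P) (suc J))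
  θ-diagonal c ξ J = trans (θ-diagonal-∂prod c ξ (unitVector J)) (*-congˡ (*-congˡ (begin
    sumTuples f l (λ t → coefficient t * ∂prod f (coord ξ ∘ t) (coord (unitVector J) ∘ t))
      ≈⟨ sumTuples-cong {l} f (λ t → *-congˡ {coefficient t}
           (∂prod-cong f {coord ξ ∘ t} {coord ξ ∘ t} (λ _ → refl) (coord-unitVector J ∘ t))) ⟩
    sumTuples f l (λ t → coefficient t * ∂prod f (coord ξ ∘ t) (δ (toℕ (suc J)) ∘ t))
      ≈⟨ coefficient-∂prod-δ≈⋆P (coord ξ) (suc J) ⟩
    (coord ξ ⋆ P) (suc J) ∎)))

  ∑-[*≋] : ∀ {s} → Unit l-prime s → ∀ a → ∑[ v ] [ toℕ v ℕ.* s ≋ a ] ≈ 1#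
  ∑-[*≋] {s} s-unit a = let v₀ , v₀s≋a = ∃-*-≋ s-unit a in begin
    ∑[ v ] [ toℕ v ℕ.* s ≋ a ]          ≈⟨ ∑-cong (λ v → *-identityʳ _) ⟨
    ∑[ v ] ([ toℕ v ℕ.* s ≋ a ] * 1#)   ≈⟨ ∑-[≋]-unique (λ v → toℕ v ℕ.* s) a (λ _ → 1#) v₀ v₀s≋a
                                             (λ v vs≋a → toℕ-≋-injective (≋-cancelˡ-* l-prime s-unit
                                               (≋-trans (≡⇒≋ (ℕₚ.*-comm s (toℕ v)))
                                               (≋-trans vs≋a (≋-trans (≋-sym v₀s≋a) (≡⇒≋ (ℕₚ.*-comm (toℕ v₀) s))))))) ⟩
    1#                                  ∎

  ∑-P : ∑ P ≈ 0#
  ∑-P = begin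
    ∑[ v ] sumFin f (λ p → χ (toℕ v ℕ.* geomExcept f p))
      ≈⟨ ∑-sumFin f (λ v p → χ (toℕ v ℕ.* geomExcept f p)) ⟩
    sumFin f (λ p → ∑[ v ] χ (toℕ v ℕ.* geomExcept f p))
      ≈⟨ sumFin-zero f (λ p → begin
           ∑[ v ] χ (toℕ v ℕ.* geomExcept f p)
             ≈⟨ ∑-distrib-- _ _ ⟩
           ∑[ v ] [ toℕ v ℕ.* geomExcept f p ≋ 0 ] - ∑[ v ] [ toℕ v ℕ.* geomExcept f p ≋ γ ]
             ≈⟨ +-cong (∑-[*≋] (geomExcept-unit p) 0) (-‿cong (∑-[*≋] (geomExcept-unit p) γ)) ⟩
           1# - 1#
             ≈⟨ -‿inverseʳ 1# ⟩
           0# ∎) ⟩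
    0# ∎

  P-zero : P zero ≈ ι f
  P-zero = begin
    sumFin f (λ p → [ 0 ≋ 0 ] - [ 0 ≋ γ ]) ≈⟨ sumFin-cong f (λ p → +-cong (reflexive ([≋]-yes (≋-refl {0})))
                                                                          (-‿cong (reflexive ([≋]-no (γ-unit ∘ ≋-sym))))) ⟩
    sumFin f (λ p → 1# - 0#)               ≈⟨ sumFin-cong f (λ p → trans (+-congˡ -0#≈0#) (+-identityʳ 1#)) ⟩
    sumFin f (λ p → 1#)                    ≈⟨ sumFin-const f 1# ⟩
    ι f * 1#                               ≈⟨ *-identityʳ _ ⟩
    ι f                                    ∎

  -- Σ_j (τ u P) j = Σ_j P j = 0, while (τ u P) 0 = P 0 = f, and l f ≠ 0 in K
  τ-P-nonConstant : ¬ ι l ≈ 0# → ¬ ι f ≈ 0# → ∀ {u} → Unit l-prime u → ¬ Constant (τ u P)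
  τ-P-nonConstant ιl≉0 ιf≉0 {u} u-unit constant = ιf≉0 (x≉0∧x*y≈0⇒y≈0 ιl≉0 (begin
    ι l * ι f          ≈⟨ ∑-const (ι f) ⟨
    ∑[ _ ] ι f         ≈⟨ ∑-cong (λ j → trans (constant j) (trans (τ-zero l-prime u-unit P) P-zero)) ⟨
    ∑ (τ u P)          ≈⟨ ∑-τ u P ⟩
    ∑ P                ≈⟨ ∑-P ⟩
    0#                 ∎))

  -- the norm of P; it is fixed by τ γ, hence lies in K N + K δ₀

  M : R
  M = ∏⋆ m (λ k → τ (γ ℕ.^ k) P)

  τγ-M : τ γ M ≐ M
  τγ-M = ≐-trans (τ-∏⋆ γ m _) (≐-trans (∏⋆-cong m (λ k → τ-∘ γ (γ ℕ.^ k) P))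
                                       (∏⋆-rotate m (λ k → τ (γ ℕ.^ k) P) (τ-≋ P γ^m≋1)))

  M-γ* : ∀ i → M (mod (γ ℕ.* toℕ i)) ≈ M i
  M-γ* i = begin
    M (mod (γ ℕ.* toℕ i))        ≈⟨ τγ-M _ ⟨
    τ γ M (mod (γ ℕ.* toℕ i))    ≈⟨ ∑-[≋]-unique (λ a → γ ℕ.* toℕ a) _ M i (≋-sym (mod-≋ _))
                                     (λ a γa≋ → toℕ-≋-injective (≋-cancelˡ-* l-prime γ-unit (≋-trans γa≋ (mod-≋ _)))) ⟩
    M i                          ∎

  M-γ^ : ∀ k → M (mod (γ ℕ.^ k)) ≈ M (mod 1)
  M-γ^ zero    = refl
  M-γ^ (suc k) = trans (reflexive (≡.cong M (mod-cong (≋-* (≋-refl {γ}) (≋-sym (mod-≋ (γ ℕ.^ k)))))))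
                       (trans (M-γ* (mod (γ ℕ.^ k))) (M-γ^ k))

  M-nonzero : ∀ i → M (suc i) ≈ M (mod 1)
  M-nonzero i = let k , γ^k≋i = discreteLog i-unit in
    trans (reflexive (≡.cong M (≡.trans (≡.sym (mod-toℕ (suc i))) (mod-cong (≋-sym γ^k≋i))))) (M-γ^ k)
    where
    i-unit : Unit l-prime (toℕ (suc i))
    i-unit = Fin.0≢1+n ∘ ≡.sym ∘ toℕ-≋-injective {suc i} {zero}

  M-decomposition : M ≐ M (mod 1) *ₛ N ⊞ (M zero - M (mod 1)) *ₛ δ₀
  M-decomposition zero    = begin
    M zero                        ≈⟨ solve 2 (λ a b → a := b :* con (+ 1) :+ (a :- b) :* con (+ 1)) refl (M zero) M₁ ⟩
    M₁ * 1# + d * 1#              ≡⟨ ≡.cong (λ x → M₁ * 1# + d * x) ([≋]-yes (≋-refl {0})) ⟨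
    M₁ * 1# + d * δ₀ zero         ∎
    where
    M₁ = M (mod 1)
    d  = M zero - M₁
  M-decomposition (suc i) = begin
    M (suc i)                     ≈⟨ M-nonzero i ⟩
    M₁                            ≈⟨ solve 2 (λ a b → a := a :* con (+ 1) :+ b :* con (+ 0)) refl M₁ d ⟩
    M₁ * 1# + d * 0#              ≡⟨ ≡.cong (λ x → M₁ * 1# + d * x) ([≋]-no (Fin.0≢1+n ∘ ≡.sym ∘ toℕ-≋-injective {suc i} {zero})) ⟨
    M₁ * 1# + d * δ₀ (suc i)      ∎
    where
    M₁ = M (mod 1)
    d  = M zero - M₁

  ⋆-M : ∀ ξ j → (ξ ⋆ M) j ≈ M (mod 1) * ∑ ξ + (M zero - M (mod 1)) * ξ j
  ⋆-M ξ j = begin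
    (ξ ⋆ M) j                                ≈⟨ ⋆-cong ≐-refl M-decomposition j ⟩
    (ξ ⋆ (M₁ *ₛ N ⊞ d *ₛ δ₀)) j              ≈⟨ ⋆-distribˡ-⊞ ξ (M₁ *ₛ N) (d *ₛ δ₀) j ⟩
    (ξ ⋆ (M₁ *ₛ N)) j + (ξ ⋆ (d *ₛ δ₀)) j    ≈⟨ +-cong (⋆-*ₛ M₁ ξ N j) (⋆-*ₛ d ξ δ₀ j) ⟩
    M₁ * (ξ ⋆ N) j + d * (ξ ⋆ δ₀) j          ≈⟨ +-cong (*-congˡ (⋆-N ξ j)) (*-congˡ (⋆-δ₀ ξ j)) ⟩
    M₁ * ∑ ξ + d * ξ j                       ∎
    where
    M₁ = M (mod 1)
    d  = M zero - M₁

  ⋆-M≈0 : ∀ ξ → (∀ j → (ξ ⋆ P) j ≈ 0#) → ∀ j → (ξ ⋆ M) j ≈ 0#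
  ⋆-M≈0 ξ ξ⋆P≈0 = annihilate m m≥1
    where
    annihilate : ∀ n → 1 ℕ.≤ n → ∀ j → (ξ ⋆ ∏⋆ n (λ k → τ (γ ℕ.^ k) P)) j ≈ 0#
    annihilate (suc n) _ j = begin
      (ξ ⋆ (τ 1 P ⋆ _)) j   ≈⟨ ⋆-assoc ξ (τ 1 P) _ j ⟨
      ((ξ ⋆ τ 1 P) ⋆ _) j   ≈⟨ ⋆-zeroˡ _ (λ i → trans (⋆-cong ≐-refl (τ-1 P) i) (ξ⋆P≈0 i)) j ⟩
      0#                    ∎

  module _ (irreducible : Irreducible (cyclotomic l) m) (ιl≉0 : ¬ ι l ≈ 0#) (ιf≉0 : ¬ ι f ≈ 0#) where

    -- otherwise M would be constant, but it is a product of non-constant factors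
    M₀-M₁≉0 : ¬ M zero - M (mod 1) ≈ 0#
    M₀-M₁≉0 d≈0 = ∏⋆-nonConstant irreducible m≥1 m (λ k → τ (γ ℕ.^ k) P)
      (λ k → τ-P-nonConstant ιl≉0 ιf≉0 (unit-^ l-prime k γ-unit))
      (λ j → trans (M≈M₁ j) (sym (M≈M₁ zero)))
      where
      M≈M₁ : ∀ j → M j ≈ M (mod 1)
      M≈M₁ zero    = begin
        M zero                             ≈⟨ solve 2 (λ a b → a := b :+ (a :- b)) refl (M zero) (M (mod 1)) ⟩
        M (mod 1) + (M zero - M (mod 1))   ≈⟨ +-congˡ d≈0 ⟩
        M (mod 1) + 0#                     ≈⟨ +-identityʳ _ ⟩
        M (mod 1)                          ∎
      M≈M₁ (suc i) = M-nonzero i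

    P-cancel : ∀ (ξ : R) → ξ zero ≈ 0# → (∀ j → (ξ ⋆ P) j ≈ 0#) → ∀ j → ξ j ≈ 0#
    P-cancel ξ ξ₀≈0 ξ⋆P≈0 j = x≉0∧x*y≈0⇒y≈0 M₀-M₁≉0 (begin
      d * ξ j                 ≈⟨ +-identityˡ _ ⟨
      0# + d * ξ j            ≈⟨ +-congʳ M₁∑ξ≈0 ⟨
      M₁ * ∑ ξ + d * ξ j      ≈⟨ ⋆-M ξ j ⟨
      (ξ ⋆ M) j               ≈⟨ ⋆-M≈0 ξ ξ⋆P≈0 j ⟩
      0#                      ∎)
      where
      M₁ = M (mod 1)
      d  = M zero - M₁
      M₁∑ξ≈0 : M₁ * ∑ ξ ≈ 0#
      M₁∑ξ≈0 = begin
        M₁ * ∑ ξ                ≈⟨ +-identityʳ _ ⟨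
        M₁ * ∑ ξ + 0#           ≈⟨ +-congˡ (trans (*-congˡ ξ₀≈0) (zeroʳ d)) ⟨
        M₁ * ∑ ξ + d * ξ zero   ≈⟨ ⋆-M ξ zero ⟨
        (ξ ⋆ M) zero            ≈⟨ ⋆-M≈0 ξ ξ⋆P≈0 zero ⟩
        0#                      ∎

  regular : Irreducible (cyclotomic l) m → ¬ ι l ≈ 0# → ¬ ι (f !) ≈ 0# →
            ∀ invf! → ι (f !) * invf! ≈ 1# → Regular f invf! (formH f m β γ)
  regular irreducible ιl≉0 ιf!≉0 invf! invf!-inverse ξ θ≈0 i =
    P-cancel irreducible ιl≉0 ιf≉0 (coord ξ) refl ξ̃⋆P≈0 (suc i)
    where
    ι-f! : ι (f !) ≈ ι f * ι (g !)
    ι-f! = ι-* f (g !)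
    ιf≉0 : ¬ ι f ≈ 0#
    ιf≉0 ιf≈0 = ιf!≉0 (trans ι-f! (trans (*-congʳ ιf≈0) (zeroˡ _)))
    ιg!≉0 : ¬ ι (g !) ≈ 0#
    ιg!≉0 ιg!≈0 = ιf!≉0 (trans ι-f! (trans (*-congˡ ιg!≈0) (zeroʳ _)))
    invf!≉0 : ¬ invf! ≈ 0#
    invf!≉0 invf!≈0 = 1≉0 (trans (sym invf!-inverse) (trans (*-congˡ invf!≈0) (zeroʳ _)))

    ξ̃⋆P-suc : ∀ J → (coord ξ ⋆ P) (suc J) ≈ 0#
    ξ̃⋆P-suc J = x≉0∧x*y≈0⇒y≈0 ιg!≉0 (x≉0∧x*y≈0⇒y≈0 invf!≉0
                  (trans (sym (θ-diagonal invf! ξ J)) (θ≈0 (λ _ → unitVector J))))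

    ξ̃⋆P≈0 : ∀ j → (coord ξ ⋆ P) j ≈ 0#
    ξ̃⋆P≈0 (suc J) = ξ̃⋆P-suc J
    ξ̃⋆P≈0 zero    = begin
      (coord ξ ⋆ P) zero                                        ≈⟨ +-identityʳ _ ⟨
      (coord ξ ⋆ P) zero + 0#                                   ≈⟨ +-congˡ (sumFin-zero m ξ̃⋆P-suc) ⟨
      sumFin l (coord ξ ⋆ P)                                    ≡⟨ sumFin≡∑ _ ⟩
      ∑ (coord ξ ⋆ P)                                           ≈⟨ ∑-⋆ (coord ξ) P ⟩
      ∑ (coord ξ) * ∑ P                                         ≈⟨ *-congˡ ∑-P ⟩
      ∑ (coord ξ) * 0#                                          ≈⟨ zeroʳ _ ⟩
      0#                                                        ∎

open Nat using (_+_; _*_; _^_; >-nonZero)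
open ℕₚ using (<-trans; suc-injective; +-comm)

lemma5p5 : ∀ {c ℓ : Level} (K : Field c ℓ) →
    (f l e γ : ℕ) →
    (f≥2 : 2 ≤ f) →
    (l-prime : Prime l) → l ≢ 2 →
    l ≡ e * f + 1 →
    -- char K ∤ f!   and   char K ≠ l
    ¬ (Field._≈_ K (FieldStuff.ι K (f !)) (Field.0# K)) →
    ¬ (Field._≈_ K (FieldStuff.ι K l) (Field.0# K)) →
    -- Gal(K(ζ_l)/K) ≅ (ℤ/lℤ)^× , i.e. Φ_l is irreducible over K
    FieldStuff.Irreducible K (FieldStuff.cyclotomic K l) (l ∸ 1) →
    -- (ℤ/lℤ)^× = ⟨γ⟩
    IsGeneratorMod l {{prime⇒nonZero l-prime}} γ →
    -- invf! = (f!)⁻¹ in K, used in θ_h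
    (invf! : Field.Carrier K) →
    Field._≈_ K (Field._*_ K (FieldStuff.ι K (f !)) invf!) (Field.1# K) →
    FieldStuff.Regular K f {{>-nonZero (<-trans (s≤s z≤n) f≥2)}} invf!
      (FieldStuff.formH K f (l ∸ 1) (γ ^ e) γ)
lemma5p5 K f 0 e γ f≥2 l-prime = ⊥-elim (¬prime[0] l-prime)
lemma5p5 K f 1 e γ f≥2 l-prime = ⊥-elim (¬prime[1] l-prime)
lemma5p5 K f 2 e γ f≥2 l-prime l≢2 = ⊥-elim (l≢2 ≡.refl)
lemma5p5 K f@(suc g) l@(suc m@(suc (suc _))) e γ f≥2 l-prime _ l≡ef+1 f!≉0 l≉0 irreducible generator =
  Regularity.regular K m (s≤s (s≤s z≤n)) l-prime γ generator e g m≡ef f≥2 irreducible l≉0 f!≉0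
  where
  m≡ef : m ≡ e * f
  m≡ef = suc-injective (≡.trans l≡ef+1 (+-comm (e * f) 1))
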